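{- Let $q$ be a prime, $d=\pi(q-1)$, and $p_1<\dots<p_d$ the primes $\le q-1$. For $n\in\{1,\dots,q-1\}$ with $n=\prod_{i=1}^d p_i^{\mu_i(n)}$ define the linear form $\mathscr{L}_n:\mathbb{F}_q^d\to\mathbb{F}_q$, $\mathscr{L}_n(\mathbf{v})=\sum_{i=1}^d\mu_i(n)v_i$. Let $k\in\mathbb{N}$. (a) If $n_1,\dots,n_k\in\{1,\dots,q-1\}$ are multiplicatively dependent, then $\mathscr{L}_{n_1},\dots,\mathscr{L}_{n_k}$ are $\mathbb{F}_q$-dependent. (b) Suppose $k<\frac{\log q}{10\log_2 q}$. Then $n_1,\dots,n_k\in\{2,3,\dots,q-1\}$ are multiplicatively independent if and only if $\mathscr{L}_{n_1},\dots,\mathscr{L}_{n_k}$ are $\mathbb{F}_q$-independent.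
   Context: Positive integers $n_1,\dots,n_r$ are multiplicatively independent if $\alpha_1=\dots=\alpha_r=0$ is the only integer solution of $n_1^{\alpha_1}\cdots n_r^{\alpha_r}=1$, and multiplicatively dependent otherwise. Forms $\mathscr{L}_{n_1},\dots,\mathscr{L}_{n_k}$ are $\mathbb{F}_q$-independent if the only $(\alpha_1,\dots,\alpha_k)\in\mathbb{F}_q^k$ with $\sum_i\alpha_i\mathscr{L}_{n_i}(\mathbf{v})=0$ for all $\mathbf{v}\in\mathbb{F}_q^d$ is the zero vector, and $\mathbb{F}_q$-dependent otherwise. $\log x:=\max\{\ln x,2\}$, $\log_2 x=\log(\log x)$. -}

module Defs where

open import Data.Nat as ℕ using (ℕ; zero; suc; _≤_; _<_)
open import Data.Nat.Divisibility using (_∣_; _∣?_)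
open import Data.Nat.Primality using (Prime; prime?)
open import Data.Integer as ℤ using (ℤ; +_; -[1+_])
open import Data.Rational as ℚ using (ℚ; 0ℚ; 1ℚ)
open import Data.Fin using (Fin; zero; suc)
open import Data.List using (List; filter; upTo; length; lookup)
open import Data.Product using (Σ; ∃; _×_; _,_)
open import Data.Sum using (_⊎_)
open import Relation.Nullary using (¬_; yes; no)
open import Relation.Binary.PropositionalEquality using (_≡_; _≢_)

∑ : ∀ k → (Fin k → ℕ) → ℕ
∑ zero    f = 0
∑ (suc k) f = f zero ℕ.+ ∑ k (λ i → f (suc i))

∏ : ∀ k → (Fin k → ℕ) → ℕ
∏ zero    f = 1
∏ (suc k) f = f zero ℕ.* ∏ k (λ i → f (suc i))

primesBelow : ℕ → List ℕ
primesBelow q = filter prime? (upTo q)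

dim : ℕ → ℕ
dim q = length (primesBelow q)

pr : (q : ℕ) → Fin (dim q) → ℕ   -- pr q i = p_{i+1}
pr q = lookup (primesBelow q)

multF : ℕ → ℕ → ℕ → ℕ
multF zero    p             n = 0
multF (suc f) 0             n = 0
multF (suc f) 1             n = 0
multF (suc f) (suc (suc p)) 0 = 0
multF (suc f) p@(suc (suc _)) n@(suc _) with p ∣? n
... | yes _ = suc (multF f p (n ℕ./ p))
... | no  _ = 0

multiplicity : ℕ → ℕ → ℕ
multiplicity p n = multF n p n

μ : (q : ℕ) → Fin (dim q) → ℕ → ℕ
μ q i n = multiplicity (pr q i) n

-- The linear form 𝓛_n : 𝔽_q^d → 𝔽_q, 𝓛_n(v) = ∑ μ_i(n) v_i.
-- Elements of 𝔽_q = ℤ/qℤ are represented by naturals < q; equalities in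
-- 𝔽_q are congruences mod q.

𝓛 : (q n : ℕ) → (Fin (dim q) → ℕ) → ℕ
𝓛 q n v = ∑ (dim q) (λ i → μ q i n ℕ.* v i)

FqDependent : (q k : ℕ) → (Fin k → ℕ) → Set
FqDependent q k n =
  Σ (Fin k → ℕ) λ α →
    (∀ j → α j < q) × (∃ λ j → α j ≢ 0) ×
    ((v : Fin (dim q) → ℕ) → (∀ i → v i < q) →
       q ∣ ∑ k (λ j → α j ℕ.* 𝓛 q (n j) v))

FqIndependent : (q k : ℕ) → (Fin k → ℕ) → Set
FqIndependent q k n = ¬ FqDependent q k n

-- Multiplicative dependence: some nonzero α ∈ ℤ^k with ∏ n_j^{α_j} = 1,
-- written out as ∏ n_j^{α_j⁺} = ∏ n_j^{α_j⁻} (α = α⁺ - α⁻).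

pos neg : ℤ → ℕ
pos (+ m)      = m
pos -[1+ m ]   = 0
neg (+ m)      = 0
neg -[1+ m ]   = suc m

MultDependent : (k : ℕ) → (Fin k → ℕ) → Set
MultDependent k n =
  Σ (Fin k → ℤ) λ α →
    (∃ λ j → α j ≢ + 0) ×
    (∏ k (λ j → n j ℕ.^ pos (α j)) ≡ ∏ k (λ j → n j ℕ.^ neg (α j)))

MultIndependent : (k : ℕ) → (Fin k → ℕ) → Set
MultIndependent k n = ¬ MultDependent k n

-- The real condition  k < log q / (10 log₂ q)  where log x = max{ln x, 2},
-- log₂ x = log(log x).  No reals are available, so it is expressed through
-- rational bounds on exp.

_^ℚ_ : ℚ → ℕ → ℚ
x ^ℚ zero  = 1ℚ
x ^ℚ suc m = x ℚ.* (x ^ℚ m)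

ℕ→ℚ : ℕ → ℚ
ℕ→ℚ m = + m ℚ./ 1

expTerm : ℚ → ℕ → ℚ
expTerm x zero    = 1ℚ
expTerm x (suc j) = expTerm x j ℚ.* x ℚ.* (+ 1 ℚ./ suc j)

expPartial : ℚ → ℕ → ℚ
expPartial x zero    = 1ℚ
expPartial x (suc N) = expPartial x N ℚ.+ expTerm x (suc N)

-- y < e^x   (for x ≥ 0: partial sums increase to e^x)
BelowExp : ℚ → ℚ → Set
BelowExp y x = ∃ λ N → y ℚ.< expPartial x N

-- e^r < y   (for r ≥ 0, y > 0: y·(1 - r/m)^m increases to y·e^{-r})
ExpBelow : ℚ → ℚ → Set
ExpBelow r y = ∃ λ m → r ℚ.< ℕ→ℚ (suc m) ×
  1ℚ ℚ.< y ℚ.* ((1ℚ ℚ.- r ℚ.* (+ 1 ℚ./ suc m)) ^ℚ suc m)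

-- k < log q / (10 · log₂ q), i.e. 10·k·log(log q) < log q, equivalently:
-- there are rationals r, s, t ≥ 0 with 10 k s < r, log q > r, log(log q) < s,
-- where log q > r  ⇔  r < 2 ∨ e^r < q,  and
-- log(log q) < s  ⇔  2 < s ∧ log q < e^s  ⇔ 2 < s ∧ ∃ t (t < e^s ∧ q < e^t).
SmallK : ℕ → ℕ → Set
SmallK k q =
  Σ ℚ λ r → Σ ℚ λ s → Σ ℚ λ t →
    0ℚ ℚ.≤ r × 0ℚ ℚ.≤ s × 0ℚ ℚ.≤ t ×
    ℕ→ℚ (10 ℕ.* k) ℚ.* s ℚ.< r ×
    (r ℚ.< ℕ→ℚ 2 ⊎ ExpBelow r (ℕ→ℚ q)) ×
    ℕ→ℚ 2 ℚ.< s × BelowExp t s × BelowExp (ℕ→ℚ q) t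

{-# OPTIONS --safe #-}

-- Let μ(n) ∈ ℕ^d be the exponent vector of n over the primes below q. By unique factorisation
-- ∏ n_j ^ a_j = ∏ n_j ^ b_j iff ∑ a_j μ(n_j) = ∑ b_j μ(n_j), so n_1, …, n_k are multiplicatively
-- dependent iff there is a nonzero integer relation ∑ α_j μ(n_j) = 0, while the forms 𝓛_{n_j} are
-- 𝔽_q-dependent iff there is such a relation modulo q.
--
-- (a) Divide an integer relation by the largest power of q dividing all its coefficients and reduce
-- it modulo q.
--
-- (b) Conversely let α be a relation modulo q with α_{j₀} ≠ 0. If (H + 1)^k > q^(k-1), pigeonhole
-- gives distinct x, x′ ∈ [0, H]^k with α_{j₀} (x_j - x′_j) ≡ α_j (x_{j₀} - x′_{j₀}) (mod q) for all j,
-- and then q divides every coordinate of ∑ (x_j - x′_j) μ(n_j). Each coordinate has absolute value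
-- below k H E, where every exponent is below E ≈ log₂ q; if k H E < q they all vanish. Both
-- requirements on H can be met once (k E)^k < q, which is what k < log q / (10 log₂ q) provides,
-- via the explicit estimates e^c ≤ (2c + 3) 4^c and 2^ρ < q when ρ < log q.

module Submission where

open import Defs

module PowerEstimates where

  open import Data.Nat.Base using (zero; suc; _+_; _*_; _^_; _∸_; _≤_; _<_; z≤n; s≤s)
  open import Data.Nat.Properties
  open import Data.Nat.Tactic.RingSolver using (solve-∀)
  open import Relation.Binary.PropositionalEquality using (_≡_; refl; trans; cong; subst)
  open import Algebra.Properties.CommutativeSemigroup *-commutativeSemigroup using (interchange)

  ^-distribʳ-* : ∀ a b e → (a * b) ^ e ≡ a ^ e * b ^ e
  ^-distribʳ-* a b zero    = refl
  ^-distribʳ-* a b (suc e) = trans (cong (a * b *_) (^-distribʳ-* a b e)) (interchange a b (a ^ e) (b ^ e))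

  binomial-lower-bound : ∀ x n → x ^ suc n + suc n * x ^ n ≤ suc x ^ suc n
  binomial-lower-bound x zero = ≤-reflexive (base x)
    where base : ∀ x → x * 1 + 1 * 1 ≡ suc x * 1
          base = solve-∀
  binomial-lower-bound x (suc n) = begin
    x ^ suc (suc n) + suc (suc n) * x ^ suc n                ≤⟨ m≤m+n _ (suc n * x ^ n) ⟩
    x ^ suc (suc n) + suc (suc n) * x ^ suc n + suc n * x ^ n ≡⟨ step x n (x ^ n) ⟩
    suc x * (x ^ suc n + suc n * x ^ n)                      ≤⟨ *-monoʳ-≤ (suc x) (binomial-lower-bound x n) ⟩
    suc x * suc x ^ suc n                                    ∎
    where
    open ≤-Reasoning
    step : ∀ x n X → x * (x * X) + suc (suc n) * (x * X) + suc n * X ≡ suc x * (x * X + suc n * X)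
    step = solve-∀

  2^-cancel-< : ∀ a b → 2 ^ a < 2 ^ b → a < b
  2^-cancel-< a b 2^a<2^b = ≰⇒> (λ b≤a → <⇒≱ 2^a<2^b (^-monoʳ-≤ 2 b≤a))

  n<2^n : ∀ n → n < 2 ^ n
  n<2^n zero    = s≤s z≤n
  n<2^n (suc n) = +-mono-≤ (m^n>0 2 n) (≤-trans (n<2^n n) (m≤m+n (2 ^ n) 0))

  -- Raising w = u + ρ by one at least doubles w ^ w, since 2 w · w ^ w ≤ (w + 1) ^ (w + 1).
  2^ρ*u^[u+ρ]≤[u+ρ]^[u+ρ] : ∀ u ρ → 2 ^ ρ * u ^ (u + ρ) ≤ (u + ρ) ^ (u + ρ)
  2^ρ*u^[u+ρ]≤[u+ρ]^[u+ρ] u zero rewrite +-identityʳ u = ≤-reflexive (+-identityʳ _)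
  2^ρ*u^[u+ρ]≤[u+ρ]^[u+ρ] u (suc ρ) rewrite +-suc u ρ = begin
    2 * 2 ^ ρ * (u * u ^ w)   ≡⟨ swap (2 ^ ρ) u (u ^ w) ⟩
    2 * u * (2 ^ ρ * u ^ w)   ≤⟨ *-mono-≤ (*-monoʳ-≤ 2 (m≤m+n u ρ)) (2^ρ*u^[u+ρ]≤[u+ρ]^[u+ρ] u ρ) ⟩
    2 * w * w ^ w             ≡⟨ double w (w ^ w) ⟩
    w * w ^ w + w * w ^ w     ≤⟨ +-monoʳ-≤ (w * w ^ w) (*-monoˡ-≤ (w ^ w) (n≤1+n w)) ⟩
    w ^ suc w + suc w * w ^ w ≤⟨ binomial-lower-bound w w ⟩
    suc w ^ suc w             ∎
    where
    open ≤-Reasoning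
    w = u + ρ
    swap : ∀ P u U → 2 * P * (u * U) ≡ 2 * u * (P * U)
    swap = solve-∀
    double : ∀ w W → 2 * w * W ≡ w * W + w * W
    double = solve-∀

  M^M<q*[M∸ρ]^M⇒2^ρ<q : ∀ {ρ M q} → ρ < M → M ^ M < q * (M ∸ ρ) ^ M → 2 ^ ρ < q
  M^M<q*[M∸ρ]^M⇒2^ρ<q {ρ} {M} {q} ρ<M M^M<q*D^M = *-cancelʳ-< ((M ∸ ρ) ^ M) (2 ^ ρ) q (begin-strict
    2 ^ ρ * (M ∸ ρ) ^ M               ≡⟨ cong (λ t → 2 ^ ρ * (M ∸ ρ) ^ t) D+ρ≡M ⟨
    2 ^ ρ * (M ∸ ρ) ^ ((M ∸ ρ) + ρ)   ≤⟨ 2^ρ*u^[u+ρ]≤[u+ρ]^[u+ρ] (M ∸ ρ) ρ ⟩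
    ((M ∸ ρ) + ρ) ^ ((M ∸ ρ) + ρ)     ≡⟨ cong (λ t → t ^ t) D+ρ≡M ⟩
    M ^ M                             <⟨ M^M<q*D^M ⟩
    q * (M ∸ ρ) ^ M                   ∎)
    where
    open ≤-Reasoning
    D+ρ≡M : (M ∸ ρ) + ρ ≡ M
    D+ρ≡M = m∸n+n≡m (<⇒≤ ρ<M)

  2n+3≤2^n : ∀ n → 4 ≤ n → 2 * n + 3 ≤ 2 ^ n
  2n+3≤2^n n 4≤n = subst (λ n → 2 * n + 3 ≤ 2 ^ n) (m+[n∸m]≡n 4≤n) (go (n ∸ 4))
    where
    go : ∀ d → 2 * (4 + d) + 3 ≤ 2 ^ (4 + d)
    go zero    = ≤-trans (n≤1+n 11) (m≤m+n 12 4)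
    go (suc d) = begin
      2 * (5 + d) + 3           ≡⟨ step d ⟩
      (2 * (4 + d) + 3) + 2     ≤⟨ +-mono-≤ (go d) (≤-trans (m≤m+n 2 14) (^-monoʳ-≤ 2 {4} {4 + d} (m≤m+n 4 d))) ⟩
      2 ^ (4 + d) + 2 ^ (4 + d) ≡⟨ cong (2 ^ (4 + d) +_) (+-identityʳ _) ⟨
      2 ^ (5 + d)               ∎
      where
      open ≤-Reasoning
      step : ∀ d → 2 * (5 + d) + 3 ≡ (2 * (4 + d) + 3) + 2
      step = solve-∀

  2n+5≤3*2^n : ∀ n → 2 ≤ n → 2 * n + 5 ≤ 3 * 2 ^ n
  2n+5≤3*2^n n 2≤n = subst (λ n → 2 * n + 5 ≤ 3 * 2 ^ n) (m+[n∸m]≡n 2≤n) (go (n ∸ 2))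
    where
    go : ∀ d → 2 * (2 + d) + 5 ≤ 3 * 2 ^ (2 + d)
    go zero    = ≤-trans (n≤1+n 9) (m≤m+n 10 2)
    go (suc d) = begin
      2 * (3 + d) + 5                       ≡⟨ step d ⟩
      (2 * (2 + d) + 5) + 2                 ≤⟨ +-monoʳ-≤ (2 * (2 + d) + 5) (≤-trans (m≤m+n 2 3) (m≤n+m 5 (2 * (2 + d)))) ⟩
      (2 * (2 + d) + 5) + (2 * (2 + d) + 5) ≤⟨ +-mono-≤ (go d) (go d) ⟩
      3 * 2 ^ (2 + d) + 3 * 2 ^ (2 + d)     ≡⟨ double (2 ^ (2 + d)) ⟩
      3 * 2 ^ (3 + d)                       ∎
      where
      open ≤-Reasoning
      step : ∀ d → 2 * (3 + d) + 5 ≡ (2 * (2 + d) + 5) + 2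
      step = solve-∀
      double : ∀ X → 3 * X + 3 * X ≡ 3 * (2 * X)
      double = solve-∀

module Multiplicity where

  open import Data.Nat.Base
    using (ℕ; zero; suc; pred; _+_; _*_; _^_; _≤_; _<_; z≤n; s≤s; NonZero; >-nonZero; nonTrivial⇒n>1)
  open import Data.Nat.Properties
  open import Data.Nat.Divisibility
  open import Data.Nat.DivMod using (_/_; m*n/n≡m; m/n<m)
  open import Data.Nat.Primality using (Prime; euclidsLemma; prime⇒nonTrivial)
  open import Data.Nat.Primality.Factorisation using (factorise)
  open import Data.Nat.Induction using (<-wellFounded)
  open import Induction.WellFounded using (Acc; acc)
  open import Data.List.Base using (_∷_)
  open import Data.List.Relation.Unary.All using (_∷_)
  open import Data.Product.Base using (∃; _×_; _,_)
  open import Data.Sum.Base using (_⊎_; inj₁; inj₂; [_,_]′)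
  open import Relation.Nullary using (¬_; yes; no; contradiction)
  open import Relation.Binary.PropositionalEquality using (_≡_; refl; sym; trans; cong; cong₂; subst; module ≡-Reasoning)
  open import Algebra.Properties.CommutativeSemigroup *-commutativeSemigroup using (xy∙z≈xz∙y)

  prime⇒1< : ∀ {p} → Prime p → 1 < p
  prime⇒1< {p} p-prime = nonTrivial⇒n>1 p {{prime⇒nonTrivial p-prime}}

  private
    multF-0 : ∀ f p → multF f p 0 ≡ 0
    multF-0 zero          p             = refl
    multF-0 (suc f)       zero          = refl
    multF-0 (suc f)       (suc zero)    = refl
    multF-0 (suc f)       (suc (suc p)) = refl

    multF-fuel : ∀ f g p n → n ≤ f → n ≤ g → multF f p n ≡ multF g p n
    multF-fuel f g p zero _ _ = trans (multF-0 f p) (sym (multF-0 g p))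
    multF-fuel (suc f) (suc g) zero          (suc n) _ _ = refl
    multF-fuel (suc f) (suc g) (suc zero)    (suc n) _ _ = refl
    multF-fuel (suc f) (suc g) (suc (suc p)) (suc n) (s≤s n≤f) (s≤s n≤g)
      with suc (suc p) ∣? suc n
    ... | yes _ = cong suc (multF-fuel f g (suc (suc p)) m (≤-trans m≤n n≤f) (≤-trans m≤n n≤g))
      where
      m = suc n / suc (suc p)
      m≤n : m ≤ n
      m≤n = <⇒≤pred (m/n<m (suc n) (suc (suc p)) (s≤s (s≤s z≤n)))
    ... | no  _ = refl

  multiplicity-∤ : ∀ {p n} → ¬ p ∣ n → multiplicity p n ≡ 0
  multiplicity-∤ {p} {zero} p∤n = contradiction (p ∣0) p∤n
  multiplicity-∤ {zero}        {suc n} p∤n = refl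
  multiplicity-∤ {suc zero}    {suc n} p∤n = refl
  multiplicity-∤ {suc (suc p)} {suc n} p∤n with suc (suc p) ∣? suc n
  ... | yes p∣n = contradiction p∣n p∤n
  ... | no  _   = refl

  multiplicity-*p : ∀ {p} m → 1 < p → 0 < m → multiplicity p (m * p) ≡ suc (multiplicity p m)
  multiplicity-*p {P@(suc (suc p))} m@(suc _) 1<P _ with P ∣? m * P
  ... | yes _ = cong suc (begin
        multF (pred (m * P)) P (m * P / P) ≡⟨ cong (multF _ P) (m*n/n≡m m P) ⟩
        multF (pred (m * P)) P m           ≡⟨ multF-fuel _ m P m (<⇒≤pred (m<m*n m P 1<P)) ≤-refl ⟩
        multiplicity P m                   ∎)
    where open ≡-Reasoning
  ... | no  P∤mP = contradiction (n∣m*n m) P∤mP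
  multiplicity-*p {suc zero} _ (s≤s ()) _

  multiplicity-1 : ∀ {p} → 1 < p → multiplicity p 1 ≡ 0
  multiplicity-1 1<p = multiplicity-∤ λ p∣1 → <⇒≢ 1<p (sym (∣1⇒≡1 p∣1))

  multiplicity>0⇒∣ : ∀ {p n} → 0 < multiplicity p n → p ∣ n
  multiplicity>0⇒∣ {p} {n} 0<μ with p ∣? n
  ... | yes p∣n = p∣n
  ... | no  p∤n = contradiction (multiplicity-∤ p∤n) (>⇒≢ 0<μ)

  private
    cofactor-pos : ∀ {m p} → 0 < m * p → 0 < m
    cofactor-pos {suc m} _ = s≤s z≤n

    cofactor-< : ∀ {m p} → 1 < p → 0 < m * p → m < m * p
    cofactor-< {m} {p} 1<p 0<mp = m<m*n m p {{>-nonZero (cofactor-pos 0<mp)}} 1<p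

    multiplicity-*-acc : ∀ {p} a b → Prime p → 0 < a → 0 < b → Acc _<_ (a + b) →
      multiplicity p (a * b) ≡ multiplicity p a + multiplicity p b
    multiplicity-*-acc {p} a b p-prime 0<a 0<b (acc rec) with p ∣? a | p ∣? b
    ... | yes (divides a′ refl) | _ = begin
      multiplicity p (a′ * p * b)         ≡⟨ cong (multiplicity p) (xy∙z≈xz∙y a′ p b) ⟩
      multiplicity p (a′ * b * p)         ≡⟨ multiplicity-*p (a′ * b) 1<p (*-mono-< {0} {a′} {0} {b} 0<a′ 0<b) ⟩
      suc (multiplicity p (a′ * b))       ≡⟨ cong suc (multiplicity-*-acc a′ b p-prime 0<a′ 0<b
                                                  (rec (+-monoˡ-< b (cofactor-< 1<p 0<a)))) ⟩
      suc (multiplicity p a′) + multiplicity p b ≡⟨ cong (_+ multiplicity p b) (multiplicity-*p a′ 1<p 0<a′) ⟨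
      multiplicity p (a′ * p) + multiplicity p b ∎
      where
      open ≡-Reasoning
      1<p : 1 < p
      1<p = prime⇒1< p-prime
      0<a′ : 0 < a′
      0<a′ = cofactor-pos 0<a
    ... | no _ | yes (divides b′ refl) = begin
      multiplicity p (a * (b′ * p))       ≡⟨ cong (multiplicity p) (*-assoc a b′ p) ⟨
      multiplicity p (a * b′ * p)         ≡⟨ multiplicity-*p (a * b′) 1<p (*-mono-< {0} {a} {0} {b′} 0<a 0<b′) ⟩
      suc (multiplicity p (a * b′))       ≡⟨ cong suc (multiplicity-*-acc a b′ p-prime 0<a 0<b′
                                                  (rec (+-monoʳ-< a (cofactor-< 1<p 0<b)))) ⟩
      suc (multiplicity p a + multiplicity p b′) ≡⟨ +-suc _ _ ⟨
      multiplicity p a + suc (multiplicity p b′) ≡⟨ cong (multiplicity p a +_) (multiplicity-*p b′ 1<p 0<b′) ⟨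
      multiplicity p a + multiplicity p (b′ * p) ∎
      where
      open ≡-Reasoning
      1<p : 1 < p
      1<p = prime⇒1< p-prime
      0<b′ : 0 < b′
      0<b′ = cofactor-pos 0<b
    ... | no p∤a | no p∤b = begin
      multiplicity p (a * b) ≡⟨ multiplicity-∤ (λ p∣ab → [ p∤a , p∤b ]′ (euclidsLemma a b p-prime p∣ab)) ⟩
      0                      ≡⟨ cong₂ _+_ (multiplicity-∤ p∤a) (multiplicity-∤ p∤b) ⟨
      multiplicity p a + multiplicity p b ∎
      where open ≡-Reasoning

  multiplicity-* : ∀ {p} a b → Prime p → 0 < a → 0 < b →
    multiplicity p (a * b) ≡ multiplicity p a + multiplicity p b
  multiplicity-* a b p-prime 0<a 0<b = multiplicity-*-acc a b p-prime 0<a 0<b (<-wellFounded (a + b))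

  p^multiplicity≤ : ∀ {p} n → 1 < p → 0 < n → p ^ multiplicity p n ≤ n
  p^multiplicity≤ {p} n 1<p 0<n = go n 0<n (<-wellFounded n)
    where
    go : ∀ n → 0 < n → Acc _<_ n → p ^ multiplicity p n ≤ n
    go n 0<n (acc rec) with p ∣? n
    ... | no  p∤n = subst (λ e → p ^ e ≤ n) (sym (multiplicity-∤ p∤n)) 0<n
    ... | yes (divides m refl) = begin
      p ^ multiplicity p (m * p) ≡⟨ cong (p ^_) (multiplicity-*p m 1<p 0<m) ⟩
      p * p ^ multiplicity p m   ≤⟨ *-monoʳ-≤ p (go m 0<m (rec (cofactor-< 1<p 0<n))) ⟩
      p * m                      ≡⟨ *-comm p m ⟩
      m * p                      ∎
      where
      open ≤-Reasoning
      0<m : 0 < m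
      0<m = cofactor-pos 0<n

  ∣⇒multiplicity>0 : ∀ {p n} → 1 < p → 0 < n → p ∣ n → 0 < multiplicity p n
  ∣⇒multiplicity>0 1<p 0<n (divides m refl) =
    subst (0 <_) (sym (multiplicity-*p m 1<p (cofactor-pos 0<n))) (s≤s z≤n)

  ≡1⊎prime-divisor : ∀ {n} → 0 < n → n ≡ 1 ⊎ ∃ λ p → Prime p × p ∣ n
  ≡1⊎prime-divisor {1} _ = inj₁ refl
  ≡1⊎prime-divisor {n@(suc (suc _))} _ with factorise n
  ... | record { factors = p ∷ _ ; isFactorisation = n≡∏ ; factorsPrime = p-prime ∷ _ } =
        inj₂ (p , p-prime , subst (p ∣_) (sym n≡∏) (m∣m*n _))

  private
    multiplicities≡0⇒≡1 : ∀ {n} → 0 < n → (∀ {p} → Prime p → multiplicity p n ≡ 0) → n ≡ 1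
    multiplicities≡0⇒≡1 0<n μ≡0 with ≡1⊎prime-divisor 0<n
    ... | inj₁ n≡1 = n≡1
    ... | inj₂ (p , p-prime , p∣n) =
          contradiction (μ≡0 p-prime) (>⇒≢ (∣⇒multiplicity>0 (prime⇒1< p-prime) 0<n p∣n))

  -- Strong induction on a: a prime factor p of a also divides b, and can be cancelled from both.
  multiplicity-injective : ∀ {a b} → 0 < a → 0 < b →
    (∀ {p} → Prime p → multiplicity p a ≡ multiplicity p b) → a ≡ b
  multiplicity-injective {a} 0<a 0<b same = go 0<a 0<b same (<-wellFounded a)
    where
    go : ∀ {a b} → 0 < a → 0 < b →
      (∀ {p} → Prime p → multiplicity p a ≡ multiplicity p b) → Acc _<_ a → a ≡ b
    go {b = b} 0<a 0<b same (acc rec) with ≡1⊎prime-divisor 0<a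
    ... | inj₁ refl = sym (multiplicities≡0⇒≡1 0<b (λ p-prime → trans (sym (same p-prime)) (multiplicity-1 (prime⇒1< p-prime))))
    ... | inj₂ (p , p-prime , divides c refl)
      with multiplicity>0⇒∣ {p} {b} (subst (0 <_) (same p-prime) (∣⇒multiplicity>0 (prime⇒1< p-prime) 0<a (n∣m*n c)))
    ...   | divides d refl = cong (_* p) (go 0<c 0<d same′ (rec (cofactor-< 1<p 0<a)))
      where
      1<p : 1 < p
      1<p = prime⇒1< p-prime
      0<p : 0 < p
      0<p = <-trans (s≤s z≤n) 1<p
      0<c : 0 < c
      0<c = cofactor-pos 0<a
      0<d : 0 < d
      0<d = cofactor-pos 0<b
      same′ : ∀ {p′} → Prime p′ → multiplicity p′ c ≡ multiplicity p′ d
      same′ {p′} p′-prime = +-cancelʳ-≡ _ _ _ (begin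
        multiplicity p′ c + multiplicity p′ p ≡⟨ multiplicity-* c p p′-prime 0<c 0<p ⟨
        multiplicity p′ (c * p)               ≡⟨ same p′-prime ⟩
        multiplicity p′ (d * p)               ≡⟨ multiplicity-* d p p′-prime 0<d 0<p ⟩
        multiplicity p′ d + multiplicity p′ p ∎)
        where open ≡-Reasoning

module FiniteSums where

  open import Data.Nat.Base as ℕ using (ℕ; zero; suc; _≤_)
  import Data.Nat.Properties as ℕ
  open import Data.Integer.Base using (ℤ; +_; 0ℤ; -1ℤ; _+_; _*_; -_; _-_)
  import Data.Integer.Properties as ℤ
  open import Data.Integer.Tactic.RingSolver using (solve-∀)
  open import Data.Integer.Divisibility.Signed using (_∣_; divides; ∣m∣n⇒∣m+n; ∣m∣n⇒∣m-n; ∣m⇒∣m*n)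
  open import Data.Fin.Base using (Fin; zero; suc)
  open import Data.Fin.Properties using (_≟_; suc-injective)
  open import Relation.Nullary using (yes; no; contradiction)
  open import Relation.Binary.PropositionalEquality
    using (_≡_; _≢_; refl; sym; trans; cong; cong₂; subst; module ≡-Reasoning)

  open import Algebra.Properties.Semiring.Sum ℤ.+-*-semiring public
    using (sum-syntax; ∑-distrib-+; ∑-comm; *-distribˡ-sum; *-distribʳ-sum; sum-cong-≗; sum-replicate-zero)

  ∑-cong : ∀ k {f g : Fin k → ℕ} → (∀ i → f i ≡ g i) → ∑ k f ≡ ∑ k g
  ∑-cong zero    f≗g = refl
  ∑-cong (suc k) f≗g = cong₂ ℕ._+_ (f≗g zero) (∑-cong k (λ i → f≗g (suc i)))

  ∑-mono-≤ : ∀ k {f g : Fin k → ℕ} → (∀ i → f i ≤ g i) → ∑ k f ≤ ∑ k g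
  ∑-mono-≤ zero    f≤g = ℕ.z≤n
  ∑-mono-≤ (suc k) f≤g = ℕ.+-mono-≤ (f≤g zero) (∑-mono-≤ k (λ i → f≤g (suc i)))

  ∑-const : ∀ k c → ∑ k (λ _ → c) ≡ k ℕ.* c
  ∑-const zero    c = refl
  ∑-const (suc k) c = cong (c ℕ.+_) (∑-const k c)

  δ : ∀ {d} → Fin d → Fin d → ℕ
  δ i i′ with i ≟ i′
  ... | yes _ = 1
  ... | no  _ = 0

  δ≤1 : ∀ {d} (i i′ : Fin d) → δ i i′ ≤ 1
  δ≤1 i i′ with i ≟ i′
  ... | yes _ = ℕ.≤-refl
  ... | no  _ = ℕ.z≤n

  ∑-*δ : ∀ d (f : Fin d → ℕ) i → ∑ d (λ i′ → f i′ ℕ.* δ i i′) ≡ f i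
  ∑-*δ (suc d) f zero = begin
    f zero ℕ.* 1 ℕ.+ ∑ d (λ i′ → f (suc i′) ℕ.* 0)
      ≡⟨ cong₂ ℕ._+_ (ℕ.*-identityʳ (f zero)) (∑-cong d (λ i′ → ℕ.*-zeroʳ (f (suc i′)))) ⟩
    f zero ℕ.+ ∑ d (λ _ → 0)                       ≡⟨ cong (f zero ℕ.+_) (trans (∑-const d 0) (ℕ.*-zeroʳ d)) ⟩
    f zero ℕ.+ 0                                   ≡⟨ ℕ.+-identityʳ (f zero) ⟩
    f zero                                         ∎
    where open ≡-Reasoning
  ∑-*δ (suc d) f (suc i) = begin
    f zero ℕ.* 0 ℕ.+ ∑ d (λ i′ → f (suc i′) ℕ.* δ (suc i) (suc i′))
      ≡⟨ cong (ℕ._+_ (f zero ℕ.* 0)) (∑-cong d (λ i′ → cong (f (suc i′) ℕ.*_) (δ-suc i′))) ⟩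
    f zero ℕ.* 0 ℕ.+ ∑ d (λ i′ → f (suc i′) ℕ.* δ i i′)
      ≡⟨ cong (ℕ._+ ∑ d (λ i′ → f (suc i′) ℕ.* δ i i′)) (ℕ.*-zeroʳ (f zero)) ⟩
    ∑ d (λ i′ → f (suc i′) ℕ.* δ i i′)                               ≡⟨ ∑-*δ d (λ i′ → f (suc i′)) i ⟩
    f (suc i)                                                        ∎
    where
    open ≡-Reasoning
    δ-suc : ∀ i′ → δ (suc i) (suc i′) ≡ δ i i′
    δ-suc i′ with i ≟ i′ | suc i ≟ suc i′
    ... | yes _  | yes _  = refl
    ... | no  _  | no  _  = refl
    ... | yes eq | no  ne = contradiction (cong suc eq) ne
    ... | no  ne | yes eq = contradiction (suc-injective eq) ne

  +-∑ : ∀ k (f : Fin k → ℕ) → + ∑ k f ≡ ∑[ i < k ] (+ f i)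
  +-∑ zero    f = refl
  +-∑ (suc k) f = trans (ℤ.pos-+ (f zero) _) (cong (_+_ (+ f zero)) (+-∑ k (λ i → f (suc i))))

  ∑-distrib-‿- : ∀ {k} (f g : Fin k → ℤ) → ∑[ i < k ] (f i - g i) ≡ ∑[ i < k ] f i - ∑[ i < k ] g i
  ∑-distrib-‿- {k} f g = begin
    ∑[ i < k ] (f i - g i)                       ≡⟨ ∑-distrib-+ f (λ i → - g i) ⟩
    ∑[ i < k ] f i + ∑[ i < k ] (- g i)       ≡⟨ cong (_+_ (∑[ i < k ] f i)) (sum-cong-≗ (λ i → sym (ℤ.-1*i≡-i (g i)))) ⟩
    ∑[ i < k ] f i + ∑[ i < k ] (-1ℤ * g i)  ≡⟨ cong (_+_ (∑[ i < k ] f i)) (*-distribˡ-sum -1ℤ g) ⟨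
    ∑[ i < k ] f i + -1ℤ * ∑[ i < k ] g i    ≡⟨ cong (_+_ (∑[ i < k ] f i)) (ℤ.-1*i≡-i _) ⟩
    ∑[ i < k ] f i - ∑[ i < k ] g i              ∎
    where open ≡-Reasoning

  ∣-∑ : ∀ {k d} (f : Fin k → ℤ) → (∀ i → d ∣ f i) → d ∣ ∑[ i < k ] f i
  ∣-∑ {zero}  f d∣f = divides 0ℤ refl
  ∣-∑ {suc k} f d∣f = ∣m∣n⇒∣m+n (d∣f zero) (∣-∑ (λ i → f (suc i)) (λ i → d∣f (suc i)))

  +-∑-* : ∀ k (a c : Fin k → ℕ) → + ∑ k (λ j → a j ℕ.* c j) ≡ ∑[ j < k ] (+ a j * + c j)
  +-∑-* k a c = trans (+-∑ k _) (sum-cong-≗ (λ j → ℤ.pos-* (a j) (c j)))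

  ∑-*-difference : ∀ k (a b c : Fin k → ℕ) →
    ∑[ j < k ] ((+ a j - + b j) * + c j) ≡ + ∑ k (λ j → a j ℕ.* c j) - + ∑ k (λ j → b j ℕ.* c j)
  ∑-*-difference k a b c = begin
    ∑[ j < k ] ((+ a j - + b j) * + c j)                    ≡⟨ sum-cong-≗ (λ j → *-distribʳ-‿- (+ a j) (+ b j) (+ c j)) ⟩
    ∑[ j < k ] (+ a j * + c j - + b j * + c j)              ≡⟨ ∑-distrib-‿- (λ j → + a j * + c j) (λ j → + b j * + c j) ⟩
    ∑[ j < k ] (+ a j * + c j) - ∑[ j < k ] (+ b j * + c j) ≡⟨ cong₂ _-_ (+-∑-* k a c) (+-∑-* k b c) ⟨
    + ∑ k (λ j → a j ℕ.* c j) - + ∑ k (λ j → b j ℕ.* c j)   ∎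
    where
    open ≡-Reasoning
    *-distribʳ-‿- : ∀ x y z → (x - y) * z ≡ x * z - y * z
    *-distribʳ-‿- = solve-∀

  ∣-∑-congruent : ∀ {k d} (x y L : Fin k → ℤ) → (∀ j → d ∣ x j - y j) →
    d ∣ ∑[ j < k ] (x j * L j) → d ∣ ∑[ j < k ] (y j * L j)
  ∣-∑-congruent {k} x y L d∣x-y d∣∑xL =
    subst (_ ∣_) (sym ∑yL≡) (∣m∣n⇒∣m-n d∣∑xL (∣-∑ (λ j → (x j - y j) * L j) (λ j → ∣m⇒∣m*n (L j) (d∣x-y j))))
    where
    split : ∀ a b c → b * c ≡ a * c - (a - b) * c
    split = solve-∀
    ∑yL≡ : ∑[ j < k ] (y j * L j) ≡ ∑[ j < k ] (x j * L j) - ∑[ j < k ] ((x j - y j) * L j)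
    ∑yL≡ = trans (sum-cong-≗ (λ j → split (x j) (y j) (L j))) (∑-distrib-‿- (λ j → x j * L j) (λ j → (x j - y j) * L j))

module ExponentRelations where

  open Multiplicity
  open FiniteSums
  open import Data.Nat.Base as ℕ using (ℕ; zero; suc; _<_; _^_; z≤n; s≤s)
  import Data.Nat.Properties as ℕ
  open import Data.Nat.Divisibility using (>⇒∤)
  open import Data.Nat.Primality using (Prime; prime?)
  open import Data.Integer.Base using (ℤ; +_; -[1+_]; 0ℤ; _+_; _*_; _-_)
  import Data.Integer.Properties as ℤ
  open import Data.Fin.Base using (Fin; zero; suc)
  open import Data.List.Base using (upTo)
  open import Data.List.Membership.Propositional using (_∈_)
  open import Data.List.Membership.Propositional.Properties using (∈-upTo⁺; ∈-filter⁺; ∈-filter⁻; ∈-lookup)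
  open import Data.List.Relation.Unary.Any using (index)
  open import Data.List.Relation.Unary.Any.Properties using (lookup-index)
  open import Data.Product.Base using (∃; _×_; _,_; proj₁; proj₂)
  open import Relation.Nullary using (¬_; Dec; yes; no)
  open import Relation.Binary.PropositionalEquality
    using (_≡_; _≢_; refl; sym; trans; cong; cong₂; module ≡-Reasoning)

  ∏-pos : ∀ k (f : Fin k → ℕ) → (∀ j → 0 < f j) → 0 < ∏ k f
  ∏-pos zero    f f>0 = s≤s z≤n
  ∏-pos (suc k) f f>0 = ℕ.*-mono-≤ (f>0 zero) (∏-pos k (λ j → f (suc j)) (λ j → f>0 (suc j)))

  multiplicity-^ : ∀ {p} a e → Prime p → 0 < a → multiplicity p (a ^ e) ≡ e ℕ.* multiplicity p a
  multiplicity-^ a zero    p-prime 0<a = multiplicity-1 (prime⇒1< p-prime)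
  multiplicity-^ a (suc e) p-prime 0<a =
    trans (multiplicity-* a (a ^ e) p-prime 0<a (ℕ.m^n>0 a {{ℕ.>-nonZero 0<a}} e))
          (cong (multiplicity _ a ℕ.+_) (multiplicity-^ a e p-prime 0<a))

  multiplicity-∏^ : ∀ {p} k (n e : Fin k → ℕ) → Prime p → (∀ j → 0 < n j) →
    multiplicity p (∏ k (λ j → n j ^ e j)) ≡ ∑ k (λ j → e j ℕ.* multiplicity p (n j))
  multiplicity-∏^ zero    n e p-prime n>0 = multiplicity-1 (prime⇒1< p-prime)
  multiplicity-∏^ (suc k) n e p-prime n>0 =
    trans (multiplicity-* _ _ p-prime (ℕ.m^n>0 (n zero) {{ℕ.>-nonZero (n>0 zero)}} (e zero))
                                 (∏-pos k _ (λ j → ℕ.m^n>0 (n (suc j)) {{ℕ.>-nonZero (n>0 (suc j))}} (e (suc j)))))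
          (cong₂ ℕ._+_ (multiplicity-^ (n zero) (e zero) p-prime (n>0 zero))
                       (multiplicity-∏^ k (λ j → n (suc j)) (λ j → e (suc j)) p-prime (λ j → n>0 (suc j))))

  pr-prime : ∀ q i → Prime (pr q i)
  pr-prime q i = proj₂ (∈-filter⁻ prime? {xs = upTo q} (∈-lookup i))

  pr-surjective : ∀ {q p} → Prime p → p < q → ∃ λ i → pr q i ≡ p
  pr-surjective {q} {p} p-prime p<q = index p∈ , sym (lookup-index p∈)
    where
    p∈ : p ∈ primesBelow q
    p∈ = ∈-filter⁺ prime? (∈-upTo⁺ p<q) p-prime

  IsRelation : ∀ q {k} → (Fin k → ℕ) → (Fin k → ℤ) → Set
  IsRelation q {k} n α = ∀ i → ∑[ j < k ] (α j * + μ q i (n j)) ≡ 0ℤ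

  module _ {q k} (n : Fin k → ℕ) (n-range : ∀ j → 0 < n j × n j < q) where

    private
      n>0 : ∀ j → 0 < n j
      n>0 j = proj₁ (n-range j)

    ∏^-≡⇒exponentSums-≡ : ∀ (a b : Fin k → ℕ) →
      ∏ k (λ j → n j ^ a j) ≡ ∏ k (λ j → n j ^ b j) →
      ∀ i → ∑ k (λ j → a j ℕ.* μ q i (n j)) ≡ ∑ k (λ j → b j ℕ.* μ q i (n j))
    ∏^-≡⇒exponentSums-≡ a b ∏≡ i = begin
      ∑ k (λ j → a j ℕ.* μ q i (n j))        ≡⟨ multiplicity-∏^ k n a (pr-prime q i) n>0 ⟨
      multiplicity (pr q i) (∏ k (λ j → n j ^ a j)) ≡⟨ cong (multiplicity (pr q i)) ∏≡ ⟩
      multiplicity (pr q i) (∏ k (λ j → n j ^ b j)) ≡⟨ multiplicity-∏^ k n b (pr-prime q i) n>0 ⟩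
      ∑ k (λ j → b j ℕ.* μ q i (n j))        ∎
      where open ≡-Reasoning

    exponentSums-≡⇒∏^-≡ : ∀ (a b : Fin k → ℕ) →
      (∀ i → ∑ k (λ j → a j ℕ.* μ q i (n j)) ≡ ∑ k (λ j → b j ℕ.* μ q i (n j))) →
      ∏ k (λ j → n j ^ a j) ≡ ∏ k (λ j → n j ^ b j)
    exponentSums-≡⇒∏^-≡ a b sums≡ = multiplicity-injective (∏^-pos a) (∏^-pos b) same
      where
      ∏^-pos : ∀ e → 0 < ∏ k (λ j → n j ^ e j)
      ∏^-pos e = ∏-pos k _ (λ j → ℕ.m^n>0 (n j) {{ℕ.>-nonZero (n>0 j)}} (e j))
      same : ∀ {p} → Prime p → multiplicity p (∏ k (λ j → n j ^ a j)) ≡ multiplicity p (∏ k (λ j → n j ^ b j))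
      same {p} p-prime = begin
        multiplicity p (∏ k (λ j → n j ^ a j))      ≡⟨ multiplicity-∏^ k n a p-prime n>0 ⟩
        ∑ k (λ j → a j ℕ.* multiplicity p (n j))    ≡⟨ exponentSums-≡ (p ℕ.<? q) ⟩
        ∑ k (λ j → b j ℕ.* multiplicity p (n j))    ≡⟨ multiplicity-∏^ k n b p-prime n>0 ⟨
        multiplicity p (∏ k (λ j → n j ^ b j))      ∎
        where
        open ≡-Reasoning
        -- Primes p ≥ q divide no n j, so only the primes pr q i contribute.
        vanish : ¬ p ℕ.< q → ∀ e → ∑ k (λ j → e j ℕ.* multiplicity p (n j)) ≡ 0
        vanish p≮q e = trans (∑-cong k (λ j → trans (cong (e j ℕ.*_) (μ≡0 j)) (ℕ.*-zeroʳ (e j))))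
                             (trans (∑-const k 0) (ℕ.*-zeroʳ k))
          where
          μ≡0 : ∀ j → multiplicity p (n j) ≡ 0
          μ≡0 j = multiplicity-∤ (>⇒∤ {{ℕ.>-nonZero (n>0 j)}} (ℕ.<-≤-trans (proj₂ (n-range j)) (ℕ.≮⇒≥ p≮q)))
        exponentSums-≡ : Dec (p ℕ.< q) →
          ∑ k (λ j → a j ℕ.* multiplicity p (n j)) ≡ ∑ k (λ j → b j ℕ.* multiplicity p (n j))
        exponentSums-≡ (yes p<q) with i , refl ← pr-surjective p-prime p<q = sums≡ i
        exponentSums-≡ (no  p≮q) = trans (vanish p≮q a) (sym (vanish p≮q b))

    private
      pos-neg : ∀ a → + pos a - + neg a ≡ a
      pos-neg (+ m)    = ℤ.+-identityʳ (+ m)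
      pos-neg -[1+ m ] = refl

      relation-sum : ∀ (α : Fin k → ℤ) i → ∑[ j < k ] (α j * + μ q i (n j)) ≡
        + ∑ k (λ j → pos (α j) ℕ.* μ q i (n j)) - + ∑ k (λ j → neg (α j) ℕ.* μ q i (n j))
      relation-sum α i = trans (sum-cong-≗ (λ j → cong (_* + μ q i (n j)) (sym (pos-neg (α j)))))
                               (∑-*-difference k (λ j → pos (α j)) (λ j → neg (α j)) (λ j → μ q i (n j)))

    multDependent⇒relation : MultDependent k n → ∃ λ α → (∃ λ j → α j ≢ 0ℤ) × IsRelation q n α
    multDependent⇒relation (α , α≢0 , ∏≡) = α , α≢0 , λ i →
      trans (relation-sum α i) (ℤ.i≡j⇒i-j≡0 (cong +_ (∏^-≡⇒exponentSums-≡ (λ j → pos (α j)) (λ j → neg (α j)) ∏≡ i)))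

    relation⇒multDependent : ∀ (α : Fin k → ℤ) → (∃ λ j → α j ≢ 0ℤ) → IsRelation q n α → MultDependent k n
    relation⇒multDependent α α≢0 rel = α , α≢0 , exponentSums-≡⇒∏^-≡ (λ j → pos (α j)) (λ j → neg (α j)) λ i →
      ℤ.+-injective (ℤ.i-j≡0⇒i≡j _ _ (trans (sym (relation-sum α i)) (rel i)))

module ModularRelations where

  open Multiplicity
  open FiniteSums
  open ExponentRelations
  open import Data.Nat.Base as ℕ using (ℕ; _<_; NonZero; z≤n; s≤s)
  import Data.Nat.Properties as ℕ
  import Data.Nat.Divisibility as ℕ using (_∣_)
  open import Data.Nat.Primality using (Prime; prime⇒nonZero)
  open import Data.Nat.Induction using (<-wellFounded)
  open import Induction.WellFounded using (Acc; acc)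
  open import Data.Integer.Base as ℤ using (ℤ; +_; 0ℤ; _+_; _*_; _-_; ∣_∣; _%ℕ_; _/ℕ_)
  import Data.Integer.Properties as ℤ
  open import Data.Integer.Divisibility.Signed
    using (_∣_; _∣?_; divides; ∣⇒∣ᵤ; ∣m∣n⇒∣m-n; ∣m⇒∣m*n)
  open import Data.Integer.DivMod using (a≡a%ℕn+[a/ℕn]*n; n%ℕd<d)
  open import Data.Integer.Tactic.RingSolver using (solve-∀)
  open import Data.Fin.Base using (Fin)
  open import Data.Fin.Properties using (all?; ¬∀⟶∃¬)
  open import Data.Product.Base using (∃; _×_; _,_)
  open import Function.Base using (_∘_)
  open import Relation.Nullary using (¬_; yes; no)
  open import Relation.Binary.PropositionalEquality
    using (_≡_; _≢_; refl; sym; trans; cong; subst; module ≡-Reasoning)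

  relation-cong : ∀ q {k} (n : Fin k → ℕ) {α β : Fin k → ℤ} →
    (∀ j → α j ≡ β j) → IsRelation q n α → IsRelation q n β
  relation-cong q n α≗β rel i = trans (sum-cong-≗ (λ j → cong (_* + μ q i (n j)) (sym (α≗β j)))) (rel i)

  relation-*-cancel : ∀ q {k} (n : Fin k → ℕ) (γ : Fin k → ℤ) c .{{_ : ℤ.NonZero c}} →
    IsRelation q n (λ j → γ j * c) → IsRelation q n γ
  relation-*-cancel q {k} n γ c rel i = ℤ.*-cancelˡ-≡ c _ _ (begin
    c * ∑[ j < k ] (γ j * + μ q i (n j))   ≡⟨ *-distribˡ-sum c (λ j → γ j * + μ q i (n j)) ⟩
    ∑[ j < k ] (c * (γ j * + μ q i (n j))) ≡⟨ sum-cong-≗ (λ j → swap c (γ j) (+ μ q i (n j))) ⟩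
    ∑[ j < k ] (γ j * c * + μ q i (n j))   ≡⟨ rel i ⟩
    0ℤ                                     ≡⟨ ℤ.*-zeroʳ c ⟨
    c * 0ℤ                                 ∎)
    where
    open ≡-Reasoning
    swap : ∀ x y z → x * (y * z) ≡ y * x * z
    swap = solve-∀

  -- While q divides every coefficient, divide the relation by q; |α j₀| decreases each time.
  relation-not-divisible : ∀ q {k} (n : Fin k → ℕ) → 1 < q → (α : Fin k → ℤ) →
    (∃ λ j → α j ≢ 0ℤ) → IsRelation q n α →
    ∃ λ β → IsRelation q n β × ∃ λ j → ¬ (+ q ∣ β j)
  relation-not-divisible q {k} n 1<q α (j₀ , α≢0) rel = go α α≢0 rel (<-wellFounded ∣ α j₀ ∣)
    where
    instance
      q≢0 : NonZero q
      q≢0 = ℕ.>-nonZero (ℕ.<-trans (s≤s z≤n) 1<q)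
    go : ∀ α → α j₀ ≢ 0ℤ → IsRelation q n α → Acc _<_ ∣ α j₀ ∣ →
      ∃ λ β → IsRelation q n β × ∃ λ j → ¬ (+ q ∣ β j)
    go α α≢0 rel (acc rec) with all? (λ j → + q ∣? α j)
    ... | no ¬q∣α = α , rel , ¬∀⟶∃¬ k _ (λ j → + q ∣? α j) ¬q∣α
    ... | yes q∣α = go γ γ≢0 (relation-*-cancel q n γ (+ q) (relation-cong q n α≡γq rel)) (rec ∣γ∣<∣α∣)
      where
      γ : Fin k → ℤ
      γ j = _∣_.quotient (q∣α j)
      α≡γq : ∀ j → α j ≡ γ j * + q
      α≡γq j = _∣_.equality (q∣α j)
      γ≢0 : γ j₀ ≢ 0ℤ
      γ≢0 γ≡0 = α≢0 (trans (α≡γq j₀) (cong (_* + q) γ≡0))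
      ∣γ∣<∣α∣ : ∣ γ j₀ ∣ < ∣ α j₀ ∣
      ∣γ∣<∣α∣ = subst (∣ γ j₀ ∣ <_) (sym (trans (cong ∣_∣ (α≡γq j₀)) (ℤ.abs-* (γ j₀) (+ q))))
                  (ℕ.m<m*n ∣ γ j₀ ∣ q {{ℕ.≢-nonZero (γ≢0 ∘ ℤ.∣i∣≡0⇒i≡0)}} 1<q)

  relation⇒forms-vanish : ∀ q {k} (n : Fin k → ℕ) (β : Fin k → ℤ) → IsRelation q n β →
    ∀ v → ∑[ j < k ] (β j * + 𝓛 q (n j) v) ≡ 0ℤ
  relation⇒forms-vanish q {k} n β rel v = begin
    ∑[ j < k ] (β j * + 𝓛 q (n j) v)                      ≡⟨ sum-cong-≗ (λ j → cong (β j *_) (+-∑-* d (λ i → μ q i (n j)) v)) ⟩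
    ∑[ j < k ] (β j * ∑[ i < d ] (+ μ q i (n j) * + v i)) ≡⟨ sum-cong-≗ (λ j → *-distribˡ-sum (β j) (λ i → + μ q i (n j) * + v i)) ⟩
    ∑[ j < k ] ∑[ i < d ] (β j * (+ μ q i (n j) * + v i)) ≡⟨ ∑-comm (λ j i → β j * (+ μ q i (n j) * + v i)) ⟩
    ∑[ i < d ] ∑[ j < k ] (β j * (+ μ q i (n j) * + v i)) ≡⟨ sum-cong-≗ (λ i → sum-cong-≗ (λ j → ℤ.*-assoc (β j) _ (+ v i))) ⟨
    ∑[ i < d ] ∑[ j < k ] (β j * + μ q i (n j) * + v i)   ≡⟨ sum-cong-≗ (λ i → *-distribʳ-sum (+ v i) (λ j → β j * + μ q i (n j))) ⟨
    ∑[ i < d ] (∑[ j < k ] (β j * + μ q i (n j)) * + v i) ≡⟨ sum-cong-≗ (λ i → cong (_* + v i) (rel i)) ⟩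
    ∑[ i < d ] (0ℤ * + v i)                               ≡⟨ sum-replicate-zero d ⟩
    0ℤ                                                    ∎
    where
    open ≡-Reasoning
    d = dim q

  relation⇒fqDependent : ∀ q {k} (n : Fin k → ℕ) .{{_ : NonZero q}} (β : Fin k → ℤ) →
    IsRelation q n β → (∃ λ j → ¬ (+ q ∣ β j)) → FqDependent q k n
  relation⇒fqDependent q {k} n β rel (j₁ , q∤β) = b , (λ j → n%ℕd<d (β j) q) , (j₁ , b≢0) , q∣∑
    where
    b : Fin k → ℕ
    b j = β j %ℕ q
    β≡b : ∀ j → + q ∣ β j - + b j
    β≡b j = divides (β j /ℕ q) (begin
      β j - + b j                         ≡⟨ cong (_- + b j) (a≡a%ℕn+[a/ℕn]*n (β j) q) ⟩
      + b j + (β j /ℕ q) * + q - + b j    ≡⟨ cancel (+ b j) _ ⟩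
      (β j /ℕ q) * + q                    ∎)
      where
      open ≡-Reasoning
      cancel : ∀ x y → x + y - x ≡ y
      cancel = solve-∀
    b≢0 : b j₁ ≢ 0
    b≢0 b≡0 = q∤β (subst (+ q ∣_) (trans (cong (λ r → β j₁ - + r) b≡0) (ℤ.+-identityʳ (β j₁))) (β≡b j₁))
    q∣∑ : ∀ v → (∀ i → v i < q) → q ℕ.∣ ∑ k (λ j → b j ℕ.* 𝓛 q (n j) v)
    q∣∑ v _ = ∣⇒∣ᵤ (subst (+ q ∣_) (sym (+-∑-* k b (λ j → 𝓛 q (n j) v)))
                 (∣-∑-congruent β (λ j → + b j) (λ j → + 𝓛 q (n j) v) β≡b
                   (subst (+ q ∣_) (sym (relation⇒forms-vanish q n β rel v)) (divides 0ℤ refl))))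

  multDependent⇒fqDependent : ∀ q → Prime q → ∀ k (n : Fin k → ℕ) → (∀ j → 0 < n j × n j < q) →
    MultDependent k n → FqDependent q k n
  multDependent⇒fqDependent q q-prime k n n-range dep
    with α , α≢0 , rel ← multDependent⇒relation n n-range dep
    with β , relβ , q∤β ← relation-not-divisible q n (prime⇒1< q-prime) α α≢0 rel
    = relation⇒fqDependent q n {{prime⇒nonZero q-prime}} β relβ q∤β

module Lifting where

  open PowerEstimates
  open Multiplicity
  open FiniteSums
  open ExponentRelations
  open import Data.Nat.Base as ℕ using (ℕ; zero; suc; _≤_; _<_; _^_; _∸_; NonZero; z≤n; s≤s)
  import Data.Nat.Properties as ℕ
  import Data.Nat.Divisibility as ℕ using (_∣_; ∣⇒≤)
  open import Data.Nat.DivMod using (_/_; _%_; m≡m%n+[m/n]*n; m%n<n; m/n*n≤m)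
  open import Data.Nat.Primality using (Prime; euclidsLemma; prime⇒nonZero)
  open import Data.Integer.Base as ℤ using (ℤ; +_; 0ℤ; _+_; _*_; _-_; _%ℕ_; _/ℕ_)
  import Data.Integer.Properties as ℤ
  open import Data.Integer.Divisibility.Signed
    using (_∣_; divides; ∣⇒∣ᵤ; ∣ᵤ⇒∣; ∣m∣n⇒∣m+n; ∣n⇒∣m*n; ∣m⇒∣m*n)
  open import Data.Integer.DivMod using (a≡a%ℕn+[a/ℕn]*n; n%ℕd<d)
  open import Data.Integer.Tactic.RingSolver using (solve-∀)
  open import Data.Fin.Base as Fin using (Fin; zero; suc; toℕ; fromℕ<; funToFin; finToFun; combine; punchIn)
  open import Data.Fin.Properties as Fin
    using (pigeonhole; ¬∀⟶∃¬; funToFin-finToFin; finToFun-funToFin; toℕ-fromℕ<; toℕ-injective; toℕ<n; punchIn-punchOut)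
  open import Data.Product.Base using (∃; ∃₂; _×_; _,_; proj₁; proj₂)
  open import Data.Sum.Base using (_⊎_; map; [_,_]′)
  open import Function.Base using (id; flip)
  open import Relation.Nullary using (¬_; yes; no; contradiction)
  open import Relation.Binary.PropositionalEquality
    using (_≡_; _≢_; refl; sym; trans; cong; cong₂; subst; module ≡-Reasoning)
  open import Algebra.Properties.CommutativeSemigroup ℕ.*-commutativeSemigroup using (x∙yz≈y∙xz)

  funToFin-cong : ∀ {m n} {f g : Fin m → Fin n} → (∀ i → f i ≡ g i) → funToFin f ≡ funToFin g
  funToFin-cong {zero}  f≗g = refl
  funToFin-cong {suc m} f≗g = cong₂ combine (f≗g zero) (funToFin-cong (λ i → f≗g (suc i)))

  functions-pigeonhole : ∀ {k m k′ r} (f : (Fin k → Fin m) → (Fin k′ → Fin r)) → r ^ k′ < m ^ k →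
    ∃₂ λ x x′ → (∃ λ j → x j ≢ x′ j) × (∀ i → f x i ≡ f x′ i)
  functions-pigeonhole {k} {m} f r^k′<m^k
    with i₁ , i₂ , i₁<i₂ , g≡ ← pigeonhole r^k′<m^k (λ i → funToFin (f (finToFun i)))
    = finToFun i₁ , finToFun i₂ , x≢x′ , f≡
    where
    f≡ : ∀ i → f (finToFun i₁) i ≡ f (finToFun i₂) i
    f≡ i = trans (sym (finToFun-funToFin (f (finToFun i₁)) i))
                (trans (cong (λ t → finToFun t i) g≡) (finToFun-funToFin (f (finToFun i₂)) i))
    x≢x′ : ∃ λ j → finToFun i₁ j ≢ finToFun i₂ j
    x≢x′ = ¬∀⟶∃¬ k _ (λ j → finToFun i₁ j Fin.≟ finToFun i₂ j) λ x≗x′ →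
      Fin.<⇒≢ i₁<i₂ (trans (sym (funToFin-finToFin {k} {m} i₁)) (trans (funToFin-cong x≗x′) (funToFin-finToFin {k} {m} i₂)))

  %ℕ-≡⇒∣- : ∀ a b q .{{_ : NonZero q}} → a %ℕ q ≡ b %ℕ q → + q ∣ a - b
  %ℕ-≡⇒∣- a b q a≡b = divides (a /ℕ q - b /ℕ q) (begin
    a - b                                                  ≡⟨ cong₂ _-_ (a≡a%ℕn+[a/ℕn]*n a q) (a≡a%ℕn+[a/ℕn]*n b q) ⟩
    (+ (a %ℕ q) + a /ℕ q * + q) - (+ (b %ℕ q) + b /ℕ q * + q) ≡⟨ cong (λ r → (+ (a %ℕ q) + a /ℕ q * + q) - (+ r + b /ℕ q * + q)) a≡b ⟨
    (+ (a %ℕ q) + a /ℕ q * + q) - (+ (a %ℕ q) + b /ℕ q * + q) ≡⟨ cancel (+ (a %ℕ q)) (a /ℕ q) (b /ℕ q) (+ q) ⟩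
    (a /ℕ q - b /ℕ q) * + q                                ∎)
    where
    open ≡-Reasoning
    cancel : ∀ r s t u → (r + s * u) - (r + t * u) ≡ (s - t) * u
    cancel = solve-∀

  differenceℤ : ∀ {k m} → (Fin k → Fin m) → (Fin k → Fin m) → Fin k → ℤ
  differenceℤ x x′ j = + toℕ (x j) - + toℕ (x′ j)

  -- Pigeonhole on the residues of α j₀ x j - α j x j₀ for j ≠ j₀, of which there are q ^ k′.
  modular-collision : ∀ q .{{_ : NonZero q}} k′ H (α : Fin (suc k′) → ℕ) (j₀ : Fin (suc k′)) →
    q ^ k′ < suc H ^ suc k′ →
    ∃₂ λ (x x′ : Fin (suc k′) → Fin (suc H)) → (∃ λ j → x j ≢ x′ j) ×
      ∀ j → + q ∣ + α j₀ * differenceℤ x x′ j - + α j * differenceℤ x x′ j₀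
  modular-collision q k′ H α j₀ count = from-collision (functions-pigeonhole residues count)
    where
    y : (Fin (suc k′) → Fin (suc H)) → Fin (suc k′) → ℤ
    y x j = + α j₀ * + toℕ (x j) - + α j * + toℕ (x j₀)
    residues : (Fin (suc k′) → Fin (suc H)) → Fin k′ → Fin q
    residues x j′ = fromℕ< (n%ℕd<d (y x (punchIn j₀ j′)) q)
    rearrange : ∀ a b u u′ v v′ → (a * u - b * v) - (a * u′ - b * v′) ≡ a * (u - u′) - b * (v - v′)
    rearrange = solve-∀
    vanish : ∀ a u → a * u - a * u ≡ 0ℤ
    vanish = solve-∀
    from-collision : (∃₂ λ x x′ → (∃ λ j → x j ≢ x′ j) × (∀ j′ → residues x j′ ≡ residues x′ j′)) →
      ∃₂ λ (x x′ : Fin (suc k′) → Fin (suc H)) → (∃ λ j → x j ≢ x′ j) ×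
        ∀ j → + q ∣ + α j₀ * differenceℤ x x′ j - + α j * differenceℤ x x′ j₀
    from-collision (x , x′ , x≢x′ , same) = x , x′ , x≢x′ , congruent
      where
      congruent : ∀ j → + q ∣ + α j₀ * differenceℤ x x′ j - + α j * differenceℤ x x′ j₀
      congruent j with j₀ Fin.≟ j
      ... | yes refl = subst (+ q ∣_) (sym (vanish (+ α j₀) (differenceℤ x x′ j₀))) (divides 0ℤ refl)
      ... | no j₀≢j =
        subst (+ q ∣_) (rearrange (+ α j₀) (+ α j) (+ toℕ (x j)) (+ toℕ (x′ j)) (+ toℕ (x j₀)) (+ toℕ (x′ j₀)))
          (%ℕ-≡⇒∣- (y x j) (y x′ j) q (begin
            y x j %ℕ q                    ≡⟨ cong (λ j → y x j %ℕ q) (punchIn-punchOut j₀≢j) ⟨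
            y x (punchIn j₀ j′) %ℕ q      ≡⟨ toℕ-fromℕ< _ ⟨
            toℕ (residues x j′)           ≡⟨ cong toℕ (same j′) ⟩
            toℕ (residues x′ j′)          ≡⟨ toℕ-fromℕ< _ ⟩
            y x′ (punchIn j₀ j′) %ℕ q     ≡⟨ cong (λ j → y x′ j %ℕ q) (punchIn-punchOut j₀≢j) ⟩
            y x′ j %ℕ q                   ∎))
        where
        open ≡-Reasoning
        j′ = Fin.punchOut j₀≢j

  euclidsLemmaℤ : ∀ {p} (a b : ℤ) → Prime p → + p ∣ a * b → + p ∣ a ⊎ + p ∣ b
  euclidsLemmaℤ a b p-prime p∣ab =
    map ∣ᵤ⇒∣ ∣ᵤ⇒∣ (euclidsLemma ℤ.∣ a ∣ ℤ.∣ b ∣ p-prime (subst (_ ℕ.∣_) (ℤ.abs-* a b) (∣⇒∣ᵤ p∣ab)))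

  -- a j₀ · ∑ z c = ∑ (a j₀ z j - a j z j₀) c j + z j₀ · ∑ a c, and q cannot divide a j₀.
  cross-multiplication : ∀ {q k} → Prime q → (a z c : Fin k → ℤ) (j₀ : Fin k) → ¬ (+ q ∣ a j₀) →
    (∀ j → + q ∣ a j₀ * z j - a j * z j₀) → + q ∣ ∑[ j < k ] (a j * c j) → + q ∣ ∑[ j < k ] (z j * c j)
  cross-multiplication {q} {k} q-prime a z c j₀ q∤a₀ q∣cross q∣∑ac =
    [ flip contradiction q∤a₀ , id ]′ (euclidsLemmaℤ (a j₀) (∑[ j < k ] (z j * c j)) q-prime (subst (+ q ∣_) (sym expand) q∣sum))
    where
    w : Fin k → ℤ
    w j = (a j₀ * z j - a j * z j₀) * c j
    expand : a j₀ * ∑[ j < k ] (z j * c j) ≡ ∑[ j < k ] w j + z j₀ * ∑[ j < k ] (a j * c j)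
    expand = begin
      a j₀ * ∑[ j < k ] (z j * c j)                      ≡⟨ *-distribˡ-sum (a j₀) (λ j → z j * c j) ⟩
      ∑[ j < k ] (a j₀ * (z j * c j))                    ≡⟨ sum-cong-≗ (λ j → split (a j₀) (z j) (c j) (a j) (z j₀)) ⟩
      ∑[ j < k ] (w j + z j₀ * (a j * c j))              ≡⟨ ∑-distrib-+ w (λ j → z j₀ * (a j * c j)) ⟩
      ∑[ j < k ] w j + ∑[ j < k ] (z j₀ * (a j * c j))   ≡⟨ cong (_+_ (∑[ j < k ] w j)) (*-distribˡ-sum (z j₀) (λ j → a j * c j)) ⟨
      ∑[ j < k ] w j + z j₀ * ∑[ j < k ] (a j * c j)     ∎
      where
      open ≡-Reasoning
      split : ∀ a₀ zⱼ cⱼ aⱼ z₀ → a₀ * (zⱼ * cⱼ) ≡ (a₀ * zⱼ - aⱼ * z₀) * cⱼ + z₀ * (aⱼ * cⱼ)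
      split = solve-∀
    q∣sum : + q ∣ ∑[ j < k ] w j + z j₀ * ∑[ j < k ] (a j * c j)
    q∣sum = ∣m∣n⇒∣m+n (∣-∑ w (λ j → ∣m⇒∣m*n (c j) (q∣cross j))) (∣n⇒∣m*n (z j₀) q∣∑ac)

  ∣-difference-of-residues : ∀ {q a b} → a < q → b < q → + q ∣ + a - + b → a ≡ b
  ∣-difference-of-residues {q} {a} {b} a<q b<q q∣a-b =
    ℤ.+-injective (ℤ.i-j≡0⇒i≡j (+ a) (+ b) (ℤ.∣i∣≡0⇒i≡0 (small-multiple ∣a-b∣<q (∣⇒∣ᵤ q∣a-b))))
    where
    ∣a-b∣<q : ℤ.∣ + a - + b ∣ < q
    ∣a-b∣<q = subst (_< q) (cong ℤ.∣_∣ (sym (ℤ.[+m]-[+n]≡m⊖n a b)))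
                (ℕ.≤-<-trans (ℤ.∣m⊝n∣≤m⊔n a b) (ℕ.⊔-pres-<m a<q b<q))
    small-multiple : ∀ {m} → m < q → q ℕ.∣ m → m ≡ 0
    small-multiple {zero}  _   _   = refl
    small-multiple {suc m} m<q q∣m = contradiction (ℕ.∣⇒≤ q∣m) (ℕ.<⇒≱ m<q)

  multiplicity<exponent : ∀ {p n q E} → 1 < p → 0 < n → n < q → q ≤ 2 ^ E → multiplicity p n < E
  multiplicity<exponent {p} {n} {q} {E} 1<p 0<n n<q q≤2^E = 2^-cancel-< _ E (begin-strict
    2 ^ multiplicity p n ≤⟨ ℕ.^-monoˡ-≤ (multiplicity p n) 1<p ⟩
    p ^ multiplicity p n ≤⟨ p^multiplicity≤ n 1<p 0<n ⟩
    n                    <⟨ n<q ⟩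
    q                    ≤⟨ q≤2^E ⟩
    2 ^ E                ∎)
    where open ℕ.≤-Reasoning

  -- H = ⌊(q - 1) / K⌋ is the largest H with H K < q, so q ≤ (H + 1) K and q ^ (k′ + 1) < (H + 1) ^ (k′ + 1) q.
  choose-H : ∀ q k′ K → 0 < K → K ^ suc k′ < q → ∃ λ H → H ℕ.* K < q × q ^ k′ < suc H ^ suc k′
  choose-H q k′ K@(suc _) _ K^k<q = H , HK<q , ℕ.*-cancelʳ-< (K ^ suc k′) (q ^ k′) (suc H ^ suc k′) (begin-strict
      q ^ k′ ℕ.* K ^ suc k′    <⟨ ℕ.*-monoʳ-< (q ^ k′) {{ℕ.m^n≢0 q k′}} K^k<q ⟩
      q ^ k′ ℕ.* q             ≡⟨ ℕ.*-comm (q ^ k′) q ⟩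
      q ^ suc k′               ≤⟨ ℕ.^-monoˡ-≤ (suc k′) q≤[H+1]K ⟩
      (suc H ℕ.* K) ^ suc k′   ≡⟨ ^-distribʳ-* (suc H) K (suc k′) ⟩
      suc H ^ suc k′ ℕ.* K ^ suc k′ ∎)
    where
    open ℕ.≤-Reasoning
    instance
      q≢0 : NonZero q
      q≢0 = ℕ.>-nonZero (ℕ.<-≤-trans (ℕ.m^n>0 K (suc k′)) (ℕ.<⇒≤ K^k<q))
    H = (q ∸ 1) / K
    HK<q : H ℕ.* K < q
    HK<q = ℕ.≤-<-trans (m/n*n≤m (q ∸ 1) K) (ℕ.≤-reflexive (ℕ.suc-pred q))
    q≤[H+1]K : q ≤ suc H ℕ.* K
    q≤[H+1]K = begin
      q                               ≡⟨ ℕ.suc-pred q ⟨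
      suc (q ∸ 1)                     ≡⟨ cong suc (m≡m%n+[m/n]*n (q ∸ 1) K) ⟩
      suc ((q ∸ 1) % K ℕ.+ H ℕ.* K)   ≤⟨ ℕ.+-monoˡ-≤ (H ℕ.* K) (m%n<n (q ∸ 1) K) ⟩
      K ℕ.+ H ℕ.* K                   ∎

  forms-vanish⇒q∣exponentSums : ∀ {q k} (n : Fin k → ℕ) (α : Fin k → ℕ) → 1 < q →
    ((v : Fin (dim q) → ℕ) → (∀ i → v i < q) → q ℕ.∣ ∑ k (λ j → α j ℕ.* 𝓛 q (n j) v)) →
    ∀ i → q ℕ.∣ ∑ k (λ j → α j ℕ.* μ q i (n j))
  forms-vanish⇒q∣exponentSums {q} {k} n α 1<q forms i =
    subst (q ℕ.∣_) (∑-cong k (λ j → cong (α j ℕ.*_) (∑-*δ (dim q) (λ i′ → μ q i′ (n j)) i)))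
      (forms (δ i) (λ i′ → ℕ.≤-<-trans (δ≤1 i i′) 1<q))

  ExponentBound : ℕ → ℕ → Set
  ExponentBound k q = ∃ λ E → q ≤ 2 ^ E × (k ℕ.* E) ^ k < q

  exponent>0 : ∀ {q E} → 1 < q → q ≤ 2 ^ E → 0 < E
  exponent>0 {E = zero}  1<q q≤1 = contradiction q≤1 (ℕ.<⇒≱ 1<q)
  exponent>0 {E = suc _} _   _   = s≤s z≤n

  fqDependent⇒multDependent : ∀ q → Prime q → ∀ k (n : Fin k → ℕ) → (∀ j → 0 < n j × n j < q) →
    ExponentBound k q → FqDependent q k n → MultDependent k n
  fqDependent⇒multDependent q q-prime zero n _ _ (_ , _ , (() , _) , _)
  fqDependent⇒multDependent q q-prime k@(suc k′) n n-range (E , q≤2^E , small) (α , α<q , (j₀ , α≢0) , forms)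
    with H , HK<q , count ← choose-H q k′ (k ℕ.* E)
                              (ℕ.*-mono-≤ {1} {k} (s≤s z≤n) (exponent>0 {E = E} (prime⇒1< q-prime) q≤2^E)) small
    with x , x′ , x≢x′ , congruent ← modular-collision q {{prime⇒nonZero q-prime}} k′ H α j₀ count
    = relation⇒multDependent n n-range (differenceℤ x x′) (difference≢0 x≢x′) relation
    where
    1<q : 1 < q
    1<q = prime⇒1< q-prime
    difference≢0 : (∃ λ j → x j ≢ x′ j) → ∃ λ j → differenceℤ x x′ j ≢ 0ℤ
    difference≢0 (j , xj≢x′j) = j , λ d≡0 → xj≢x′j (toℕ-injective (ℤ.+-injective (ℤ.i-j≡0⇒i≡j _ _ d≡0)))
    q∤α₀ : ¬ (+ q ∣ + α j₀)
    q∤α₀ q∣α₀ = ℕ.<⇒≱ (α<q j₀) (ℕ.∣⇒≤ {{ℕ.≢-nonZero α≢0}} (∣⇒∣ᵤ q∣α₀))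
    q∣∑αμ : ∀ i → + q ∣ ∑[ j < k ] (+ α j * + μ q i (n j))
    q∣∑αμ i = subst (+ q ∣_) (+-∑-* k α (λ j → μ q i (n j)))
                (∣ᵤ⇒∣ (forms-vanish⇒q∣exponentSums n α 1<q forms i))
    weighted-sum-< : ∀ i (y : Fin k → Fin (suc H)) → ∑ k (λ j → toℕ (y j) ℕ.* μ q i (n j)) < q
    weighted-sum-< i y = ℕ.≤-<-trans (begin
      ∑ k (λ j → toℕ (y j) ℕ.* μ q i (n j)) ≤⟨ ∑-mono-≤ k (λ j → ℕ.*-mono-≤ (ℕ.≤-pred (toℕ<n (y j))) (ℕ.<⇒≤ (μ<E j))) ⟩
      ∑ k (λ _ → H ℕ.* E)                   ≡⟨ ∑-const k (H ℕ.* E) ⟩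
      k ℕ.* (H ℕ.* E)                       ≡⟨ x∙yz≈y∙xz k H E ⟩
      H ℕ.* (k ℕ.* E)                       ∎) HK<q
      where
      open ℕ.≤-Reasoning
      μ<E : ∀ j → μ q i (n j) < E
      μ<E j = multiplicity<exponent (prime⇒1< (pr-prime q i)) (proj₁ (n-range j)) (proj₂ (n-range j)) q≤2^E
    relation : IsRelation q n (differenceℤ x x′)
    relation i = trans S≡P-P′ (ℤ.i≡j⇒i-j≡0 (cong +_ P≡P′))
      where
      S≡P-P′ : ∑[ j < k ] (differenceℤ x x′ j * + μ q i (n j)) ≡
               + ∑ k (λ j → toℕ (x j) ℕ.* μ q i (n j)) - + ∑ k (λ j → toℕ (x′ j) ℕ.* μ q i (n j))
      S≡P-P′ = ∑-*-difference k (λ j → toℕ (x j)) (λ j → toℕ (x′ j)) (λ j → μ q i (n j))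
      q∣S : + q ∣ ∑[ j < k ] (differenceℤ x x′ j * + μ q i (n j))
      q∣S = cross-multiplication q-prime (λ j → + α j) (differenceℤ x x′) (λ j → + μ q i (n j)) j₀
              q∤α₀ congruent (q∣∑αμ i)
      P≡P′ : ∑ k (λ j → toℕ (x j) ℕ.* μ q i (n j)) ≡ ∑ k (λ j → toℕ (x′ j) ℕ.* μ q i (n j))
      P≡P′ = ∣-difference-of-residues (weighted-sum-< i x) (weighted-sum-< i x′) (subst (+ q ∣_) S≡P-P′ q∣S)

module FactorialEstimates where

  open PowerEstimates
  open import Data.Nat.Base using (zero; suc; _+_; _*_; _^_; _∸_; _≤_; _!; z≤n; s≤s; >-nonZero)
  open import Data.Nat.Properties
  open import Data.Nat.Tactic.RingSolver using (solve-∀)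
  open import Data.Sum.Base using (inj₁; inj₂)
  open import Relation.Binary.PropositionalEquality using (_≡_; refl; sym; trans; cong; subst)

  -- (1 + 1/(n+1)) ^ (n+2) ≤ (1 + 1/n) ^ (n+1) with denominators cleared, using n (n+2) + 1 = (n+1)².
  [1+1/n]^[1+n]-decreasing : ∀ n → (2 + n) * (n * (2 + n)) ^ suc n ≤ (1 + n) * ((1 + n) * (1 + n)) ^ suc n
  [1+1/n]^[1+n]-decreasing n = begin
    (2 + n) * X ^ suc n                               ≡⟨ split n (X ^ n) ⟩
    (1 + n) * X ^ suc n + X * X ^ n                   ≤⟨ +-monoʳ-≤ ((1 + n) * X ^ suc n) (*-monoˡ-≤ (X ^ n) (n≤1+n X)) ⟩
    (1 + n) * X ^ suc n + (1 + X) * X ^ n             ≡⟨ cong (λ t → (1 + n) * X ^ suc n + t * X ^ n) (square n) ⟩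
    (1 + n) * X ^ suc n + (1 + n) * (1 + n) * X ^ n   ≡⟨ factor (1 + n) (X ^ suc n) (X ^ n) ⟩
    (1 + n) * (X ^ suc n + suc n * X ^ n)             ≤⟨ *-monoʳ-≤ (1 + n) (binomial-lower-bound X n) ⟩
    (1 + n) * suc X ^ suc n                           ≡⟨ cong (λ t → (1 + n) * t ^ suc n) (square n) ⟩
    (1 + n) * ((1 + n) * (1 + n)) ^ suc n             ∎
    where
    open ≤-Reasoning
    X = n * (2 + n)
    split : ∀ n Y → (2 + n) * (n * (2 + n) * Y) ≡ (1 + n) * (n * (2 + n) * Y) + n * (2 + n) * Y
    split = solve-∀
    square : ∀ n → 1 + n * (2 + n) ≡ (1 + n) * (1 + n)
    square = solve-∀
    factor : ∀ m A B → m * A + m * m * B ≡ m * (A + m * B)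
    factor = solve-∀

  [1+n]^[1+n]≤4*n^[1+n] : ∀ n → 1 ≤ n → (1 + n) ^ (1 + n) ≤ 4 * n ^ (1 + n)
  [1+n]^[1+n]≤4*n^[1+n] (suc zero) _ = ≤-refl
  [1+n]^[1+n]≤4*n^[1+n] (suc (suc m)) _ =
    *-cancelʳ-≤ _ _ (b ^ (1 + b)) {{>-nonZero (m^n>0 b (1 + b))}} (begin
      Q ^ (2 + b) * b ^ (1 + b)        ≡⟨ regroup ⟩
      Q * (b * Q) ^ (1 + b)            ≤⟨ [1+1/n]^[1+n]-decreasing b ⟩
      P * (P * P) ^ (1 + b)            ≡⟨ cong (P *_) (^-distribʳ-* P P (1 + b)) ⟩
      P * (P ^ (1 + b) * P ^ (1 + b))  ≡⟨ *-assoc P (P ^ (1 + b)) (P ^ (1 + b)) ⟨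
      P ^ (2 + b) * P ^ (1 + b)        ≤⟨ *-monoʳ-≤ (P ^ (2 + b)) ([1+n]^[1+n]≤4*n^[1+n] (suc m) (s≤s z≤n)) ⟩
      P ^ (2 + b) * (4 * b ^ (1 + b))  ≡⟨ swap (P ^ (2 + b)) (b ^ (1 + b)) ⟩
      4 * P ^ (2 + b) * b ^ (1 + b)    ∎)
    where
    open ≤-Reasoning
    b = suc m
    P = 1 + b
    Q = 2 + b
    regroup : Q ^ (2 + b) * b ^ (1 + b) ≡ Q * (b * Q) ^ (1 + b)
    regroup = trans (*-assoc Q (Q ^ (1 + b)) (b ^ (1 + b)))
                (cong (Q *_) (trans (*-comm (Q ^ (1 + b)) (b ^ (1 + b))) (sym (^-distribʳ-* b Q (1 + b)))))
    swap : ∀ X Y → X * (4 * Y) ≡ 4 * X * Y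
    swap = solve-∀

  [1+n]^n≤4*n^n : ∀ n → (1 + n) ^ n ≤ 4 * n ^ n
  [1+n]^n≤4*n^n zero    = s≤s z≤n
  [1+n]^n≤4*n^n (suc n) = *-cancelˡ-≤ (2 + n) (begin
    (2 + n) * (2 + n) ^ (1 + n)         ≤⟨ [1+n]^[1+n]≤4*n^[1+n] (suc n) (s≤s z≤n) ⟩
    4 * (1 + n) ^ (2 + n)               ≡⟨ swap (1 + n) ((1 + n) ^ (1 + n)) ⟩
    (1 + n) * (4 * (1 + n) ^ (1 + n))   ≤⟨ *-monoˡ-≤ (4 * (1 + n) ^ (1 + n)) (n≤1+n (1 + n)) ⟩
    (2 + n) * (4 * (1 + n) ^ (1 + n))   ∎)
    where
    open ≤-Reasoning
    swap : ∀ a X → 4 * (a * X) ≡ a * (4 * X)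
    swap = solve-∀

  n^n≤4^n*n! : ∀ n → n ^ n ≤ 4 ^ n * n !
  n^n≤4^n*n! zero    = s≤s z≤n
  n^n≤4^n*n! (suc n) = begin
    (1 + n) * (1 + n) ^ n            ≤⟨ *-monoʳ-≤ (1 + n) ([1+n]^n≤4*n^n n) ⟩
    (1 + n) * (4 * n ^ n)            ≤⟨ *-monoʳ-≤ (1 + n) (*-monoʳ-≤ 4 (n^n≤4^n*n! n)) ⟩
    (1 + n) * (4 * (4 ^ n * n !))    ≡⟨ regroup (1 + n) (4 ^ n) (n !) ⟩
    4 * 4 ^ n * ((1 + n) * n !)      ∎
    where
    open ≤-Reasoning
    regroup : ∀ a X Y → a * (4 * (X * Y)) ≡ 4 * X * (a * Y)
    regroup = solve-∀

  private
    c^[c+d]≤4^c*[c+d]! : ∀ c d → c ^ (c + d) ≤ 4 ^ c * (c + d) !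
    c^[c+d]≤4^c*[c+d]! c zero rewrite +-identityʳ c = n^n≤4^n*n! c
    c^[c+d]≤4^c*[c+d]! c (suc d) rewrite +-suc c d = begin
      c * c ^ (c + d)                   ≤⟨ *-monoʳ-≤ c (c^[c+d]≤4^c*[c+d]! c d) ⟩
      c * (4 ^ c * (c + d) !)           ≤⟨ *-monoˡ-≤ (4 ^ c * (c + d) !) (≤-trans (m≤m+n c d) (n≤1+n (c + d))) ⟩
      suc (c + d) * (4 ^ c * (c + d) !) ≡⟨ swap (suc (c + d)) (4 ^ c) ((c + d) !) ⟩
      4 ^ c * (suc (c + d) * (c + d) !) ∎
      where
      open ≤-Reasoning
      swap : ∀ a X Y → a * (X * Y) ≡ X * (a * Y)
      swap = solve-∀

    c^j*c!≤c^c*j! : ∀ c d j → j + d ≡ c → c ^ j * c ! ≤ c ^ c * j !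
    c^j*c!≤c^c*j! c zero j refl rewrite +-identityʳ j = ≤-refl
    c^j*c!≤c^c*j! c (suc d) j j+d≡c = *-cancelˡ-≤ c {{>-nonZero (≤-trans (s≤s z≤n) j<c)}} (begin
      c * (c ^ j * c !)      ≡⟨ *-assoc c (c ^ j) (c !) ⟨
      c ^ suc j * c !        ≤⟨ c^j*c!≤c^c*j! c d (suc j) (trans (sym (+-suc j d)) j+d≡c) ⟩
      c ^ c * (suc j * j !)  ≤⟨ *-monoʳ-≤ (c ^ c) (*-monoˡ-≤ (j !) j<c) ⟩
      c ^ c * (c * j !)      ≡⟨ swap c (c ^ c) (j !) ⟩
      c * (c ^ c * j !)      ∎)
      where
      open ≤-Reasoning
      j<c : suc j ≤ c
      j<c = subst (suc j ≤_) j+d≡c (≤-trans (s≤s (m≤m+n j d)) (≤-reflexive (sym (+-suc j d))))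
      swap : ∀ a X Y → X * (a * Y) ≡ a * (X * Y)
      swap = solve-∀

  c^j≤4^c*j! : ∀ c j → c ^ j ≤ 4 ^ c * j !
  c^j≤4^c*j! c j with ≤-<-connex c j
  ... | inj₁ c≤j = subst (λ t → c ^ t ≤ 4 ^ c * t !) (m+[n∸m]≡n c≤j) (c^[c+d]≤4^c*[c+d]! c (j ∸ c))
  ... | inj₂ j<c = *-cancelʳ-≤ _ _ (c !) {{>-nonZero (1≤n! c)}} (begin
    c ^ j * c !          ≤⟨ c^j*c!≤c^c*j! c (c ∸ j) j (m+[n∸m]≡n (<⇒≤ j<c)) ⟩
    c ^ c * j !          ≤⟨ *-monoˡ-≤ (j !) (n^n≤4^n*n! c) ⟩
    4 ^ c * c ! * j !    ≡⟨ *-right-swap (4 ^ c) (c !) (j !) ⟩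
    4 ^ c * j ! * c !    ∎)
    where
    open ≤-Reasoning
    *-right-swap : ∀ X Y Z → X * Y * Z ≡ X * Z * Y
    *-right-swap = solve-∀

module ExpSeriesBound where

  open FactorialEstimates
  open import Data.Nat.Base using (ℕ; zero; suc; _+_; _*_; _^_; _∸_; _≤_; _!; s≤s)
  open import Data.Nat.Properties
  open import Data.Nat.Tactic.RingSolver using (solve-∀)
  open import Data.Sum.Base using (inj₁; inj₂)
  open import Relation.Binary.PropositionalEquality using (_≡_; subst)

  -- scaledExpSum c N = N! · ∑_{j ≤ N} c ^ j / j!
  scaledExpSum : ℕ → ℕ → ℕ
  scaledExpSum c zero    = 1
  scaledExpSum c (suc N) = suc N * scaledExpSum c N + c ^ suc N

  expBound : ℕ → ℕ
  expBound c = (2 * c + 3) * 4 ^ c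

  scaledExpSum≤[1+N]*4^c*N! : ∀ c N → scaledExpSum c N ≤ suc N * 4 ^ c * N !
  scaledExpSum≤[1+N]*4^c*N! c zero = ≤-trans (m^n>0 4 c) (≤-reflexive (pad (4 ^ c)))
    where pad : ∀ X → X ≡ 1 * X * 1
          pad = solve-∀
  scaledExpSum≤[1+N]*4^c*N! c (suc N) = begin
    suc N * scaledExpSum c N + c ^ suc N
      ≤⟨ +-mono-≤ (*-monoʳ-≤ (suc N) (scaledExpSum≤[1+N]*4^c*N! c N)) (c^j≤4^c*j! c (suc N)) ⟩
    suc N * (suc N * 4 ^ c * N !) + 4 ^ c * (suc N * N !) ≡⟨ regroup (suc N) (4 ^ c) (N !) ⟩
    suc (suc N) * 4 ^ c * (suc N * N !)                   ∎
    where
    open ≤-Reasoning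
    regroup : ∀ n F G → n * (n * F * G) + F * (n * G) ≡ (1 + n) * F * (n * G)
    regroup = solve-∀

  -- Beyond N = 2c the terms c ^ N / N! at least halve, so the tail is at most twice the last term.
  private
    scaledExpSum-tail : ∀ c d → scaledExpSum c (2 * c + d) + 2 * c ^ (2 * c + d) ≤ expBound c * (2 * c + d) !
    scaledExpSum-tail c zero rewrite +-identityʳ (2 * c) = begin
      scaledExpSum c (2 * c) + 2 * c ^ (2 * c)
        ≤⟨ +-mono-≤ (scaledExpSum≤[1+N]*4^c*N! c (2 * c)) (*-monoʳ-≤ 2 (c^j≤4^c*j! c (2 * c))) ⟩
      suc (2 * c) * 4 ^ c * (2 * c) ! + 2 * (4 ^ c * (2 * c) !) ≡⟨ regroup (2 * c) (4 ^ c) ((2 * c) !) ⟩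
      (2 * c + 3) * 4 ^ c * (2 * c) !                           ∎
      where
      open ≤-Reasoning
      regroup : ∀ m F G → suc m * F * G + 2 * (F * G) ≡ (m + 3) * F * G
      regroup = solve-∀
    scaledExpSum-tail c (suc d) rewrite +-suc (2 * c) d = begin
      suc N * S + c * C + 2 * (c * C) ≡⟨ collect (suc N) S c C ⟩
      suc N * S + (3 * c) * C         ≤⟨ +-monoʳ-≤ (suc N * S) (*-monoˡ-≤ C 3c≤2[N+1]) ⟩
      suc N * S + (2 * suc N) * C     ≡⟨ factor (suc N) S C ⟩
      suc N * (S + 2 * C)             ≤⟨ *-monoʳ-≤ (suc N) (scaledExpSum-tail c d) ⟩
      suc N * (expBound c * N !)      ≡⟨ swap (suc N) (expBound c) (N !) ⟩
      expBound c * (suc N * N !)      ∎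
      where
      open ≤-Reasoning
      N = 2 * c + d
      S = scaledExpSum c N
      C = c ^ N
      3c≤2[N+1] : 3 * c ≤ 2 * suc N
      3c≤2[N+1] = ≤-trans (*-monoˡ-≤ c (n≤1+n 3)) (≤-trans (≤-reflexive (double c))
                    (*-monoʳ-≤ 2 (≤-trans (m≤m+n (2 * c) d) (n≤1+n N))))
        where double : ∀ c → 4 * c ≡ 2 * (2 * c)
              double = solve-∀
      collect : ∀ n a c C → n * a + c * C + 2 * (c * C) ≡ n * a + (3 * c) * C
      collect = solve-∀
      factor : ∀ n a C → n * a + (2 * n) * C ≡ n * (a + 2 * C)
      factor = solve-∀
      swap : ∀ n K G → n * (K * G) ≡ K * (n * G)
      swap = solve-∀

  scaledExpSum≤expBound*N! : ∀ c N → scaledExpSum c N ≤ expBound c * N !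
  scaledExpSum≤expBound*N! c N with ≤-<-connex N (2 * c)
  ... | inj₁ N≤2c = ≤-trans (scaledExpSum≤[1+N]*4^c*N! c N)
                      (*-monoˡ-≤ (N !) (*-monoˡ-≤ (4 ^ c) (≤-trans (s≤s N≤2c) 1+2c≤2c+3)))
    where 1+2c≤2c+3 = ≤-trans (m≤n+m (suc (2 * c)) 2) (≤-reflexive (+-comm 3 (2 * c)))
  ... | inj₂ 2c<N = subst (λ t → scaledExpSum c t ≤ expBound c * t !) (m+[n∸m]≡n (<⇒≤ 2c<N))
                      (≤-trans (m≤m+n _ _) (scaledExpSum-tail c (N ∸ 2 * c)))

module RationalEmbedding where

  open import Data.Nat.Base as ℕ using (ℕ; zero; suc; z≤n; s≤s)
  import Data.Nat.Properties as ℕ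
  import Data.Nat.Coprimality as ℕ using (sym; 1-coprimeTo)
  open import Data.Integer.Base as ℤ using (+_; -[1+_]; +≤+; +<+)
  import Data.Integer.Properties as ℤ
  open import Data.Rational.Base using (ℚ; mkℚ; _/_; 0ℚ; 1ℚ; _+_; _*_; _≤_; _<_; *≤*; *<*; nonNegative)
  import Data.Rational.Properties as ℚ
  open import Data.Product.Base using (∃; _×_; _,_)
  open import Relation.Nullary using (yes; no)
  open import Relation.Binary.PropositionalEquality using (_≡_; refl; sym; trans; cong; cong₂; subst; subst₂)
  open import Algebra.Bundles using (CommutativeMonoid)

  private
    ι : ℕ → ℚ
    ι m = mkℚ (+ m) 0 (ℕ.sym (ℕ.1-coprimeTo m))

    ℕ→ℚ≡ι : ∀ m → ℕ→ℚ m ≡ ι m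
    ℕ→ℚ≡ι m = ℚ.↥p/↧p≡p (ι m)

    *1 : ∀ a → + a ℤ.* + 1 ≡ + a
    *1 a = ℤ.*-identityʳ (+ a)

  ℕ→ℚ-+ : ∀ a b → ℕ→ℚ (a ℕ.+ b) ≡ ℕ→ℚ a + ℕ→ℚ b
  ℕ→ℚ-+ a b rewrite ℕ→ℚ≡ι a | ℕ→ℚ≡ι b =
    ℚ./-cong {p₁ = + (a ℕ.+ b)} {q₁ = 1} (trans (ℤ.pos-+ a b) (sym (cong₂ ℤ._+_ (*1 a) (*1 b)))) refl

  ℕ→ℚ-* : ∀ a b → ℕ→ℚ (a ℕ.* b) ≡ ℕ→ℚ a * ℕ→ℚ b
  ℕ→ℚ-* a b rewrite ℕ→ℚ≡ι a | ℕ→ℚ≡ι b = ℚ./-cong {p₁ = + (a ℕ.* b)} {q₁ = 1} (ℤ.pos-* a b) refl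

  ℕ→ℚ-mono-≤ : ∀ {a b} → a ℕ.≤ b → ℕ→ℚ a ≤ ℕ→ℚ b
  ℕ→ℚ-mono-≤ {a} {b} a≤b rewrite ℕ→ℚ≡ι a | ℕ→ℚ≡ι b = *≤* (subst₂ ℤ._≤_ (sym (*1 a)) (sym (*1 b)) (+≤+ a≤b))

  ℕ→ℚ-mono-< : ∀ {a b} → a ℕ.< b → ℕ→ℚ a < ℕ→ℚ b
  ℕ→ℚ-mono-< {a} {b} a<b rewrite ℕ→ℚ≡ι a | ℕ→ℚ≡ι b = *<* (subst₂ ℤ._<_ (sym (*1 a)) (sym (*1 b)) (+<+ a<b))

  ℕ→ℚ-cancel-< : ∀ {a b} → ℕ→ℚ a < ℕ→ℚ b → a ℕ.< b
  ℕ→ℚ-cancel-< {a} {b} a<b rewrite ℕ→ℚ≡ι a | ℕ→ℚ≡ι b with a<b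
  ... | *<* a*1<b*1 = ℤ.drop‿+<+ (subst₂ ℤ._<_ (*1 a) (*1 b) a*1<b*1)

  ℕ→ℚ-nonNeg : ∀ a → 0ℚ ≤ ℕ→ℚ a
  ℕ→ℚ-nonNeg a = ℕ→ℚ-mono-≤ {0} {a} z≤n

  1/[1+N]*[1+N]≡1 : ∀ N → (+ 1 / suc N) * ℕ→ℚ (suc N) ≡ 1ℚ
  1/[1+N]*[1+N]≡1 N = trans (cong₂ _*_ (ℚ.↥p/↧p≡p (mkℚ (+ 1) N (ℕ.1-coprimeTo (suc N)))) (ℕ→ℚ≡ι (suc N)))
                            (ℚ.*-inverseˡ (ι (suc N)))

  archimedean : ∀ s → 0ℚ ≤ s → ∃ λ N → s ≤ ℕ→ℚ N
  archimedean (mkℚ (+ n) d c) _ = n , subst (mkℚ (+ n) d c ≤_) (sym (ℕ→ℚ≡ι n))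
    (*≤* (subst₂ ℤ._≤_ (ℤ.pos-* n 1) (ℤ.pos-* n (suc d)) (+≤+ (ℕ.*-monoʳ-≤ n (s≤s z≤n)))))
  archimedean (mkℚ -[1+ n ] d c) (*≤* ())

  ℕ-floor : ∀ s → 0ℚ ≤ s → ∃ λ σ → ℕ→ℚ σ ≤ s × s ≤ ℕ→ℚ (suc σ)
  ℕ-floor s 0≤s with N , s≤N ← archimedean s 0≤s = search N s≤N
    where
    search : ∀ N → s ≤ ℕ→ℚ N → ∃ λ σ → ℕ→ℚ σ ≤ s × s ≤ ℕ→ℚ (suc σ)
    search zero    s≤0 = 0 , 0≤s , ℚ.≤-trans s≤0 (ℕ→ℚ-mono-≤ {0} {1} z≤n)
    search (suc N) s≤N with s ℚ.≤? ℕ→ℚ N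
    ... | yes s≤N-1 = search N s≤N-1
    ... | no  s≰N-1 = N , ℚ.<⇒≤ (ℚ.≰⇒> s≰N-1) , s≤N

  ℕ→ℚ-^ : ∀ a N → ℕ→ℚ a ^ℚ N ≡ ℕ→ℚ (a ℕ.^ N)
  ℕ→ℚ-^ a zero    = refl
  ℕ→ℚ-^ a (suc N) = trans (cong (ℕ→ℚ a *_) (ℕ→ℚ-^ a N)) (sym (ℕ→ℚ-* a (a ℕ.^ N)))

  *-mono-≤-nonNeg : ∀ {a b c d} → 0ℚ ≤ a → 0ℚ ≤ c → a ≤ b → c ≤ d → a * c ≤ b * d
  *-mono-≤-nonNeg {a} {b} {c} {d} 0≤a 0≤c a≤b c≤d =
    ℚ.≤-trans (ℚ.*-monoʳ-≤-nonNeg c {{nonNegative 0≤c}} a≤b)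
              (ℚ.*-monoˡ-≤-nonNeg b {{nonNegative (ℚ.≤-trans 0≤a a≤b)}} c≤d)

  ^ℚ-nonNeg : ∀ x N → 0ℚ ≤ x → 0ℚ ≤ x ^ℚ N
  ^ℚ-nonNeg x zero    _   = ℕ→ℚ-nonNeg 1
  ^ℚ-nonNeg x (suc N) 0≤x =
    ℚ.nonNegative⁻¹ _ {{ℚ.nonNeg*nonNeg⇒nonNeg x {{nonNegative 0≤x}} (x ^ℚ N) {{nonNegative (^ℚ-nonNeg x N 0≤x)}}}}

  ^ℚ-mono-≤ : ∀ {x y} N → 0ℚ ≤ x → x ≤ y → x ^ℚ N ≤ y ^ℚ N
  ^ℚ-mono-≤ zero    _   _   = ℚ.≤-refl
  ^ℚ-mono-≤ {x} (suc N) 0≤x x≤y = *-mono-≤-nonNeg 0≤x (^ℚ-nonNeg x N 0≤x) x≤y (^ℚ-mono-≤ N 0≤x x≤y)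

  ^ℚ-distribʳ-* : ∀ x y N → (x * y) ^ℚ N ≡ x ^ℚ N * y ^ℚ N
  ^ℚ-distribʳ-* x y zero    = sym (ℚ.*-identityˡ 1ℚ)
  ^ℚ-distribʳ-* x y (suc N) = trans (cong (x * y *_) (^ℚ-distribʳ-* x y N)) (interchange x y (x ^ℚ N) (y ^ℚ N))
    where open import Algebra.Properties.CommutativeSemigroup
            (CommutativeMonoid.commutativeSemigroup ℚ.*-1-commutativeMonoid) using (interchange)

  1^ℚN≡1 : ∀ N → 1ℚ ^ℚ N ≡ 1ℚ
  1^ℚN≡1 zero    = refl
  1^ℚN≡1 (suc N) = trans (cong (1ℚ *_) (1^ℚN≡1 N)) (ℚ.*-identityˡ 1ℚ)

module ExpPartialBound where

  open RationalEmbedding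
  open ExpSeriesBound
  open import Data.Nat.Base as ℕ using (ℕ; zero; suc; _!)
  import Data.Nat.Properties as ℕ
  open import Data.Integer.Base using (+_)
  open import Data.Rational.Base using (ℚ; _/_; 0ℚ; 1ℚ; _+_; _*_; _≤_; positive; nonNegative)
  import Data.Rational.Properties as ℚ
  open import Data.Rational.Solver using (module +-*-Solver)
  open +-*-Solver using (solve; _:+_; _:*_; _:=_)
  open import Relation.Binary.PropositionalEquality using (_≡_; refl; cong; cong₂; module ≡-Reasoning)

  expTerm*N!≡x^N : ∀ x N → expTerm x N * ℕ→ℚ (N !) ≡ x ^ℚ N
  expTerm*N!≡x^N x zero    = ℚ.*-identityˡ 1ℚ
  expTerm*N!≡x^N x (suc N) = begin
    expTerm x N * x * r * ℕ→ℚ (suc N ℕ.* N !) ≡⟨ cong (expTerm x N * x * r *_) (ℕ→ℚ-* (suc N) (N !)) ⟩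
    expTerm x N * x * r * (s * f)
      ≡⟨ solve 5 (λ T x r s f → T :* x :* r :* (s :* f) := x :* (T :* f) :* (r :* s)) refl (expTerm x N) x r s f ⟩
    x * (expTerm x N * f) * (r * s)           ≡⟨ cong₂ (λ u v → x * u * v) (expTerm*N!≡x^N x N) (1/[1+N]*[1+N]≡1 N) ⟩
    x * x ^ℚ N * 1ℚ                           ≡⟨ ℚ.*-identityʳ _ ⟩
    x ^ℚ suc N                                ∎
    where
    open ≡-Reasoning
    r = + 1 / suc N
    s = ℕ→ℚ (suc N)
    f = ℕ→ℚ (N !)

  expPartial*N!≤scaledExpSum : ∀ x c N → 0ℚ ≤ x → x ≤ ℕ→ℚ c → expPartial x N * ℕ→ℚ (N !) ≤ ℕ→ℚ (scaledExpSum c N)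
  expPartial*N!≤scaledExpSum x c zero    _   _   = ℚ.≤-reflexive (ℚ.*-identityˡ 1ℚ)
  expPartial*N!≤scaledExpSum x c (suc N) 0≤x x≤c = begin
    (P + T) * ℕ→ℚ (suc N ℕ.* N !)           ≡⟨ cong ((P + T) *_) (ℕ→ℚ-* (suc N) (N !)) ⟩
    (P + T) * (s * f)                       ≡⟨ solve 4 (λ P T s f → (P :+ T) :* (s :* f) := s :* (P :* f) :+ T :* (s :* f)) refl P T s f ⟩
    s * (P * f) + T * (s * f)               ≡⟨ cong (λ t → s * (P * f) + T * t) (ℕ→ℚ-* (suc N) (N !)) ⟨
    s * (P * f) + T * ℕ→ℚ (suc N ℕ.* N !)   ≡⟨ cong (_+_ (s * (P * f))) (expTerm*N!≡x^N x (suc N)) ⟩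
    s * (P * f) + x ^ℚ suc N                ≤⟨ ℚ.+-mono-≤ (ℚ.*-monoˡ-≤-nonNeg s {{nonNegative (ℕ→ℚ-nonNeg (suc N))}}
                                                            (expPartial*N!≤scaledExpSum x c N 0≤x x≤c))
                                                          (ℚ.≤-trans (^ℚ-mono-≤ (suc N) 0≤x x≤c) (ℚ.≤-reflexive (ℕ→ℚ-^ c (suc N)))) ⟩
    s * ℕ→ℚ (scaledExpSum c N) + ℕ→ℚ (c ℕ.^ suc N) ≡⟨ cong (_+ ℕ→ℚ (c ℕ.^ suc N)) (ℕ→ℚ-* (suc N) (scaledExpSum c N)) ⟨
    ℕ→ℚ (suc N ℕ.* scaledExpSum c N) + ℕ→ℚ (c ℕ.^ suc N) ≡⟨ ℕ→ℚ-+ (suc N ℕ.* scaledExpSum c N) (c ℕ.^ suc N) ⟨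
    ℕ→ℚ (scaledExpSum c (suc N))            ∎
    where
    open ℚ.≤-Reasoning
    P = expPartial x N
    T = expTerm x (suc N)
    s = ℕ→ℚ (suc N)
    f = ℕ→ℚ (N !)

  expPartial≤expBound : ∀ x c N → 0ℚ ≤ x → x ≤ ℕ→ℚ c → expPartial x N ≤ ℕ→ℚ (expBound c)
  expPartial≤expBound x c N 0≤x x≤c =
    ℚ.*-cancelʳ-≤-pos (ℕ→ℚ (N !)) {{positive (ℕ→ℚ-mono-< {0} {N !} (ℕ.1≤n! N))}} (begin
      expPartial x N * ℕ→ℚ (N !)     ≤⟨ expPartial*N!≤scaledExpSum x c N 0≤x x≤c ⟩
      ℕ→ℚ (scaledExpSum c N)         ≤⟨ ℕ→ℚ-mono-≤ {scaledExpSum c N} {expBound c ℕ.* N !} (scaledExpSum≤expBound*N! c N) ⟩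
      ℕ→ℚ (expBound c ℕ.* N !)       ≡⟨ ℕ→ℚ-* (expBound c) (N !) ⟩
      ℕ→ℚ (expBound c) * ℕ→ℚ (N !)   ∎)
    where open ℚ.≤-Reasoning

module ExpBelowBound where

  open RationalEmbedding
  open PowerEstimates
  open import Data.Nat.Base as ℕ using (ℕ; suc; _∸_; z≤n; s≤s)
  import Data.Nat.Properties as ℕ
  open import Data.Integer.Base using (+_; +<+)
  open import Data.Rational.Base using (ℚ; mkℚ; _/_; 0ℚ; 1ℚ; _+_; _*_; _-_; -_; _≤_; _<_; *<*; positive; nonNegative)
  import Data.Rational.Properties as ℚ
  import Data.Nat.Coprimality as ℕ using (1-coprimeTo)
  open import Data.Rational.Solver using (module +-*-Solver)
  open +-*-Solver using (solve; _:+_; _:*_; _:-_; _:=_)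
  open import Data.Product.Base using (_×_; _,_; proj₁; proj₂)
  open import Relation.Binary.PropositionalEquality using (_≡_; refl; sym; trans; cong; cong₂; subst; module ≡-Reasoning)
  open import Algebra.Bundles using (CommutativeMonoid)
  open import Algebra.Properties.CommutativeSemigroup
    (CommutativeMonoid.commutativeSemigroup ℚ.*-1-commutativeMonoid) using (x∙yz≈y∙xz)

  private
    1/[1+m]>0 : ∀ m → 0ℚ < + 1 / suc m
    1/[1+m]>0 m = subst (0ℚ <_) (sym (ℚ.↥p/↧p≡p (mkℚ (+ 1) m (ℕ.1-coprimeTo (suc m))))) (*<* (+<+ (s≤s z≤n)))

  1-r/M-bounds : ∀ m r ρ → r < ℕ→ℚ (suc m) → ℕ→ℚ ρ ≤ r →
    0ℚ ≤ 1ℚ - r * (+ 1 / suc m) × 1ℚ - r * (+ 1 / suc m) ≤ ℕ→ℚ (suc m ∸ ρ) * (+ 1 / suc m)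
  1-r/M-bounds m r ρ r<M ρ≤r = 0≤a , a≤D/M
    where
    M = suc m
    D = M ∸ ρ
    i = + 1 / M
    i*M≡1 : i * ℕ→ℚ M ≡ 1ℚ
    i*M≡1 = 1/[1+N]*[1+N]≡1 m
    0≤a : 0ℚ ≤ 1ℚ - r * i
    0≤a = ℚ.≤-trans (ℚ.≤-reflexive (sym (ℚ.+-inverseʳ (r * i))))
            (ℚ.+-monoˡ-≤ (- (r * i)) (ℚ.≤-trans (ℚ.<⇒≤ (ℚ.*-monoˡ-<-pos i {{positive (1/[1+m]>0 m)}} r<M))
                                                 (ℚ.≤-reflexive (trans (ℚ.*-comm (ℕ→ℚ M) i) i*M≡1))))
    D+ρ≡M : ℕ→ℚ D + ℕ→ℚ ρ ≡ ℕ→ℚ M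
    D+ρ≡M = trans (sym (ℕ→ℚ-+ D ρ)) (cong ℕ→ℚ (ℕ.m∸n+n≡m (ℕ.<⇒≤ (ℕ→ℚ-cancel-< {ρ} {M} (ℚ.≤-<-trans ρ≤r r<M)))))
    a≤D/M : 1ℚ - r * i ≤ ℕ→ℚ D * i
    a≤D/M = ℚ.≤-trans (ℚ.+-monoʳ-≤ 1ℚ (ℚ.neg-antimono-≤ (ℚ.*-monoʳ-≤-nonNeg i {{nonNegative (ℚ.<⇒≤ (1/[1+m]>0 m))}} ρ≤r)))
              (ℚ.≤-reflexive (begin-equality
                1ℚ - ℕ→ℚ ρ * i                  ≡⟨ cong (_- ℕ→ℚ ρ * i) i*M≡1 ⟨
                i * ℕ→ℚ M - ℕ→ℚ ρ * i           ≡⟨ cong (λ t → i * t - ℕ→ℚ ρ * i) D+ρ≡M ⟨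
                i * (ℕ→ℚ D + ℕ→ℚ ρ) - ℕ→ℚ ρ * i ≡⟨ solve 3 (λ i d p → i :* (d :+ p) :- p :* i := d :* i) refl i (ℕ→ℚ D) (ℕ→ℚ ρ) ⟩
                ℕ→ℚ D * i                       ∎))
      where open ℚ.≤-Reasoning

  M^M*[x/M]^M≡x^M : ∀ m x → ℕ→ℚ (suc m ℕ.^ suc m) * (x * (+ 1 / suc m)) ^ℚ suc m ≡ x ^ℚ suc m
  M^M*[x/M]^M≡x^M m x = begin
    ℕ→ℚ (M ℕ.^ M) * (x * i) ^ℚ M       ≡⟨ cong₂ _*_ (ℕ→ℚ-^ M M) (sym (^ℚ-distribʳ-* x i M)) ⟨
    ℕ→ℚ M ^ℚ M * (x ^ℚ M * i ^ℚ M)     ≡⟨ solve 3 (λ A X I → A :* (X :* I) := X :* (I :* A)) refl (ℕ→ℚ M ^ℚ M) (x ^ℚ M) (i ^ℚ M) ⟩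
    x ^ℚ M * (i ^ℚ M * ℕ→ℚ M ^ℚ M)     ≡⟨ cong (x ^ℚ M *_) (^ℚ-distribʳ-* i (ℕ→ℚ M) M) ⟨
    x ^ℚ M * (i * ℕ→ℚ M) ^ℚ M          ≡⟨ cong (λ t → x ^ℚ M * t ^ℚ M) (1/[1+N]*[1+N]≡1 m) ⟩
    x ^ℚ M * 1ℚ ^ℚ M                   ≡⟨ cong (x ^ℚ M *_) (1^ℚN≡1 M) ⟩
    x ^ℚ M * 1ℚ                        ≡⟨ ℚ.*-identityʳ _ ⟩
    x ^ℚ M                             ∎
    where
    open ≡-Reasoning
    M = suc m
    i = + 1 / M

  -- ExpBelow r q unfolds to 1 < q (1 - r/M) ^ M, and 1 - r/M ≤ (M - ρ)/M.
  expBelow⇒2^ρ<q : ∀ r q ρ → ExpBelow r (ℕ→ℚ q) → ℕ→ℚ ρ ≤ r → 2 ℕ.^ ρ ℕ.< q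
  expBelow⇒2^ρ<q r q ρ (m , r<M , 1<q·a^M) ρ≤r =
    M^M<q*[M∸ρ]^M⇒2^ρ<q ρ<M (ℕ→ℚ-cancel-< {M ℕ.^ M} {q ℕ.* D ℕ.^ M} (begin-strict
      ℕ→ℚ (M ℕ.^ M)                             ≡⟨ ℚ.*-identityʳ _ ⟨
      ℕ→ℚ (M ℕ.^ M) * 1ℚ                        <⟨ ℚ.*-monoʳ-<-pos (ℕ→ℚ (M ℕ.^ M)) {{positive M^M>0}} 1<q·a^M ⟩
      ℕ→ℚ (M ℕ.^ M) * (ℕ→ℚ q * a ^ℚ M)          ≤⟨ ℚ.*-monoˡ-≤-nonNeg (ℕ→ℚ (M ℕ.^ M)) {{nonNegative (ℚ.<⇒≤ M^M>0)}}
                                                     (ℚ.*-monoˡ-≤-nonNeg (ℕ→ℚ q) {{nonNegative (ℕ→ℚ-nonNeg q)}} (^ℚ-mono-≤ M 0≤a a≤D/M)) ⟩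
      ℕ→ℚ (M ℕ.^ M) * (ℕ→ℚ q * (ℕ→ℚ D * i) ^ℚ M) ≡⟨ x∙yz≈y∙xz (ℕ→ℚ (M ℕ.^ M)) (ℕ→ℚ q) ((ℕ→ℚ D * i) ^ℚ M) ⟩
      ℕ→ℚ q * (ℕ→ℚ (M ℕ.^ M) * (ℕ→ℚ D * i) ^ℚ M) ≡⟨ cong (ℕ→ℚ q *_) (M^M*[x/M]^M≡x^M m (ℕ→ℚ D)) ⟩
      ℕ→ℚ q * ℕ→ℚ D ^ℚ M                        ≡⟨ cong (ℕ→ℚ q *_) (ℕ→ℚ-^ D M) ⟩
      ℕ→ℚ q * ℕ→ℚ (D ℕ.^ M)                     ≡⟨ ℕ→ℚ-* q (D ℕ.^ M) ⟨
      ℕ→ℚ (q ℕ.* D ℕ.^ M)                       ∎))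
    where
    open ℚ.≤-Reasoning
    M = suc m
    D = M ∸ ρ
    i = + 1 / M
    a = 1ℚ - r * i
    0≤a : 0ℚ ≤ a
    0≤a = proj₁ (1-r/M-bounds m r ρ r<M ρ≤r)
    a≤D/M : a ≤ ℕ→ℚ D * i
    a≤D/M = proj₂ (1-r/M-bounds m r ρ r<M ρ≤r)
    M^M>0 : 0ℚ < ℕ→ℚ (M ℕ.^ M)
    M^M>0 = ℕ→ℚ-mono-< {0} {M ℕ.^ M} (ℕ.m^n>0 M M)
    ρ<M : ρ ℕ.< M
    ρ<M = ℕ→ℚ-cancel-< {ρ} {M} (ℚ.≤-<-trans ρ≤r r<M)

module SmallKEstimates where

  open RationalEmbedding
  open PowerEstimates
  open ExpSeriesBound
  open ExpPartialBound
  open ExpBelowBound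
  open Lifting using (ExponentBound)
  open import Data.Nat.Base using (zero; suc; _+_; _*_; _^_; _≤_; _<_; z≤n; s≤s; >-nonZero)
  open import Data.Nat.Properties
  open import Data.Nat.Tactic.RingSolver using (solve-∀)
  import Data.Rational.Base as ℚ using (_≤_; _<_; nonNegative)
  import Data.Rational.Properties as ℚ
  open import Data.Product.Base using (_,_; proj₁; proj₂)
  open import Data.Sum.Base using (_⊎_; inj₁; inj₂)
  open import Relation.Nullary using (contradiction)
  open import Relation.Binary.PropositionalEquality using (_≡_; sym; cong)

  4≤expBound : ∀ c → 4 ≤ expBound (suc c)
  4≤expBound c = ≤-trans (m≤n*m 4 (2 * suc c + 3)) (*-monoʳ-≤ (2 * suc c + 3) (*-monoʳ-≤ 4 (m^n>0 4 c)))

  expBound≤2^[3c] : ∀ c → 4 ≤ c → expBound c ≤ 2 ^ (3 * c)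
  expBound≤2^[3c] c 4≤c = begin
    (2 * c + 3) * 4 ^ c ≤⟨ *-monoˡ-≤ (4 ^ c) (2n+3≤2^n c 4≤c) ⟩
    2 ^ c * 4 ^ c       ≡⟨ ^-distribʳ-* 2 4 c ⟨
    8 ^ c               ≡⟨ ^-*-assoc 2 3 c ⟩
    2 ^ (3 * c)         ∎
    where open ≤-Reasoning

  expBound[1+σ]≤12*[2^σ]³ : ∀ σ → 2 ≤ σ → expBound (suc σ) ≤ 12 * (2 ^ σ * 2 ^ σ * 2 ^ σ)
  expBound[1+σ]≤12*[2^σ]³ σ 2≤σ = begin
    (2 * suc σ + 3) * (4 * 4 ^ σ)  ≡⟨ cong (λ t → (2 * suc σ + 3) * (4 * t)) (^-distribʳ-* 2 2 σ) ⟩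
    (2 * suc σ + 3) * (4 * (X * X)) ≡⟨ regroup σ X ⟩
    (2 * σ + 5) * 4 * X * X        ≤⟨ *-monoˡ-≤ X (*-monoˡ-≤ X (*-monoˡ-≤ 4 (2n+5≤3*2^n σ 2≤σ))) ⟩
    3 * X * 4 * X * X              ≡⟨ collect X ⟩
    12 * (X * X * X)               ∎
    where
    open ≤-Reasoning
    X = 2 ^ σ
    regroup : ∀ σ X → (2 * suc σ + 3) * (4 * (X * X)) ≡ (2 * σ + 5) * 4 * X * X
    regroup = solve-∀
    collect : ∀ X → 3 * X * 4 * X * X ≡ 12 * (X * X * X)
    collect = solve-∀

  [3*expBound[1+σ]]²≤10σ*2^[10σ] : ∀ σ → 2 ≤ σ → let E = 3 * expBound (suc σ) in E * E ≤ 10 * σ * 2 ^ (10 * σ)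
  [3*expBound[1+σ]]²≤10σ*2^[10σ] σ 2≤σ = begin
    E * E                                              ≤⟨ *-mono-≤ E≤36X³ E≤36X³ ⟩
    36 * (X * X * X) * (36 * (X * X * X))              ≡⟨ square X ⟩
    1296 * (X * X * X * X * X * X)                     ≤⟨ *-monoˡ-≤ (X * X * X * X * X * X) 1296≤10σX⁴ ⟩
    10 * σ * (X * X * X * X) * (X * X * X * X * X * X) ≡⟨ tenth-power σ X ⟩
    10 * σ * X ^ 10                                    ≡⟨ cong (10 * σ *_) (^-*-assoc 2 σ 10) ⟩
    10 * σ * 2 ^ (σ * 10)                              ≡⟨ cong (λ e → 10 * σ * 2 ^ e) (*-comm σ 10) ⟩
    10 * σ * 2 ^ (10 * σ)                              ∎
    where
    open ≤-Reasoning
    E = 3 * expBound (suc σ)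
    X = 2 ^ σ
    E≤36X³ : E ≤ 36 * (X * X * X)
    E≤36X³ = ≤-trans (*-monoʳ-≤ 3 (expBound[1+σ]≤12*[2^σ]³ σ 2≤σ)) (≤-reflexive (sym (*-assoc 3 12 (X * X * X))))
    4≤X : 4 ≤ X
    4≤X = ^-monoʳ-≤ 2 2≤σ
    1296≤10σX⁴ : 1296 ≤ 10 * σ * (X * X * X * X)
    1296≤10σX⁴ = ≤-trans (m≤m+n 1296 3824)
      (*-mono-≤ (*-monoʳ-≤ 10 2≤σ) (*-mono-≤ (*-mono-≤ (*-mono-≤ 4≤X 4≤X) 4≤X) 4≤X))
    square : ∀ X → 36 * (X * X * X) * (36 * (X * X * X)) ≡ 1296 * (X * X * X * X * X * X)
    square = solve-∀
    tenth-power : ∀ σ X → 10 * σ * (X * X * X * X) * (X * X * X * X * X * X) ≡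
                          10 * σ * (X * (X * (X * (X * (X * (X * (X * (X * (X * (X * 1))))))))))
    tenth-power = solve-∀

  -- For E = 3 · expBound (σ + 1), 2 ^ (10 k σ) < q ≤ 2 ^ E gives 10 k σ < E, so 10 σ · k E < E² ≤ 10 σ · 2 ^ (10 σ).
  small-power : ∀ σ k q → 2 ≤ σ → 2 ^ (10 * k * σ) < q → q ≤ 2 ^ (3 * expBound (suc σ)) →
    (k * (3 * expBound (suc σ))) ^ k < q
  small-power σ k q 2≤σ 2^ρ<q q≤2^E = begin-strict
    (k * E) ^ k         ≤⟨ ^-monoˡ-≤ k (<⇒≤ kE<2^[10σ]) ⟩
    (2 ^ (10 * σ)) ^ k  ≡⟨ ^-*-assoc 2 (10 * σ) k ⟩
    2 ^ (10 * σ * k)    ≡⟨ cong (2 ^_) (reorder σ k) ⟩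
    2 ^ (10 * k * σ)    <⟨ 2^ρ<q ⟩
    q                   ∎
    where
    open ≤-Reasoning
    E = 3 * expBound (suc σ)
    reorder : ∀ σ k → 10 * σ * k ≡ 10 * k * σ
    reorder = solve-∀
    regroup : ∀ σ k E → 10 * σ * (k * E) ≡ 10 * k * σ * E
    regroup = solve-∀
    ρ<E : 10 * k * σ < E
    ρ<E = 2^-cancel-< _ _ (<-≤-trans 2^ρ<q q≤2^E)
    kE<2^[10σ] : k * E < 2 ^ (10 * σ)
    kE<2^[10σ] = *-cancelˡ-< (10 * σ) (k * E) (2 ^ (10 * σ)) (begin-strict
      10 * σ * (k * E)      ≡⟨ regroup σ k E ⟩
      10 * k * σ * E        <⟨ *-monoˡ-< E {{>-nonZero (≤-<-trans z≤n ρ<E)}} ρ<E ⟩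
      E * E                 ≤⟨ [3*expBound[1+σ]]²≤10σ*2^[10σ] σ 2≤σ ⟩
      10 * σ * 2 ^ (10 * σ) ∎)

  smallK⇒exponentBound : ∀ k q → 1 < q → SmallK k q → ExponentBound k q
  smallK⇒exponentBound zero q 1<q _ = q , <⇒≤ (n<2^n q) , 1<q
  smallK⇒exponentBound k@(suc k′) q _ (r , s , t , _ , 0≤s , 0≤t , 10ks<r , r<2⊎e^r<q , 2<s , (M , t<e^s) , (N , q<e^t)) =
    3 * T , q≤2^[3T] , small-power σ k q 2≤σ 2^ρ<q q≤2^[3T]
    where
    σ = proj₁ (ℕ-floor s 0≤s)
    σ≤s : ℕ→ℚ σ ℚ.≤ s
    σ≤s = proj₁ (proj₂ (ℕ-floor s 0≤s))
    s≤1+σ : s ℚ.≤ ℕ→ℚ (suc σ)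
    s≤1+σ = proj₂ (proj₂ (ℕ-floor s 0≤s))
    T = expBound (suc σ)
    2≤σ : 2 ≤ σ
    2≤σ = ≤-pred (ℕ→ℚ-cancel-< {2} {suc σ} (ℚ.<-≤-trans 2<s s≤1+σ))
    ρ≤r : ℕ→ℚ (10 * k * σ) ℚ.≤ r
    ρ≤r = ℚ.<⇒≤ (ℚ.≤-<-trans (ℚ.≤-trans (ℚ.≤-reflexive (ℕ→ℚ-* (10 * k) σ))
            (ℚ.*-monoˡ-≤-nonNeg (ℕ→ℚ (10 * k)) {{ℚ.nonNegative (ℕ→ℚ-nonNeg (10 * k))}} σ≤s)) 10ks<r)
    2^ρ<q : 2 ^ (10 * k * σ) < q
    2^ρ<q = log-q>r r<2⊎e^r<q
      where
      log-q>r : r ℚ.< ℕ→ℚ 2 ⊎ ExpBelow r (ℕ→ℚ q) → 2 ^ (10 * k * σ) < q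
      log-q>r (inj₂ e^r<q) = expBelow⇒2^ρ<q r q (10 * k * σ) e^r<q ρ≤r
      -- r < 2 is impossible, since r ≥ ρ = 10 k σ ≥ 20.
      log-q>r (inj₁ r<2)   = contradiction (ℕ→ℚ-cancel-< {10 * k * σ} {2} (ℚ.≤-<-trans ρ≤r r<2))
                               (≤⇒≯ (≤-trans (s≤s (s≤s z≤n)) (*-mono-≤ (*-monoʳ-≤ 10 (s≤s (z≤n {k′}))) 2≤σ)))
    t<T : t ℚ.< ℕ→ℚ T
    t<T = ℚ.<-≤-trans t<e^s (expPartial≤expBound s (suc σ) M 0≤s s≤1+σ)
    q≤2^[3T] : q ≤ 2 ^ (3 * T)
    q≤2^[3T] = <⇒≤ (<-≤-trans (ℕ→ℚ-cancel-< {q} {expBound T} (ℚ.<-≤-trans q<e^t (expPartial≤expBound t T N 0≤t (ℚ.<⇒≤ t<T))))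
                               (expBound≤2^[3c] T (4≤expBound σ)))

open import Data.Nat using (ℕ; _≤_; _<_)
open import Data.Nat.Primality using (Prime)
open import Data.Fin using (Fin)
open import Data.Product using (_×_)
open import Function.Bundles using (_⇔_)

open import Data.Nat.Properties using (<⇒≤)
open import Data.Product using (_,_; map₁)
open import Function.Bundles using (mk⇔)
open Multiplicity using (prime⇒1<)
open ModularRelations using (multDependent⇒fqDependent)
open Lifting using (ExponentBound; fqDependent⇒multDependent)
open SmallKEstimates using (smallK⇒exponentBound)

lemma2p2 : (q : ℕ) → Prime q →
    ((k : ℕ) (n : Fin k → ℕ) → (∀ j → 1 ≤ n j × n j < q) →
       MultDependent k n → FqDependent q k n)
    ×
    ((k : ℕ) → SmallK k q → (n : Fin k → ℕ) → (∀ j → 2 ≤ n j × n j < q) →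
       (MultIndependent k n ⇔ FqIndependent q k n))
lemma2p2 q q-prime = multDependent⇒fqDependent q q-prime , part-b
  where
  part-b : (k : ℕ) → SmallK k q → (n : Fin k → ℕ) → (∀ j → 2 ≤ n j × n j < q) →
    MultIndependent k n ⇔ FqIndependent q k n
  part-b k small n n-range = mk⇔
    (λ mult-indep fq-dep → mult-indep (fqDependent⇒multDependent q q-prime k n n-range′ exponent-bound fq-dep))
    (λ fq-indep mult-dep → fq-indep (multDependent⇒fqDependent q q-prime k n n-range′ mult-dep))
    where
    n-range′ : ∀ j → 1 ≤ n j × n j < q
    n-range′ j = map₁ <⇒≤ (n-range j)
    exponent-bound : ExponentBound k q
    exponent-bound = smallK⇒exponentBound k q (prime⇒1< q-prime) small
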